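{- Fix a total order on the set of all atomic set partitions. Let $b_{k}$ be the number of Lyndon set partitions of $[k]$ and $B_n$ the $n$-th Bell number (number of set partitions of $[n]$, $B_0=1$). Then $$\prod_{k \geq 1} \frac{1}{(1-q^k)^{b_{k}}} = \sum_{n\geq0}B_n\, q^n.$$
   Context: For $n\ge 0$, a set partition $A$ of $[n]$ is a set of nonempty pairwise disjoint subsets (parts) of $[n]$ with union $[n]$. For $A\vdash[n]$, $B\vdash[k]$, $A|B\vdash[n+k]$ consists of the parts of $A$ together with the parts of $B$ shifted by $n$. $A\vdash[n]$ is atomic if $n\ge1$ and $A\neq B|C$ for all $B\vdash[k]$, $C\vdash[n-k]$, $0<k<n$. Every set partition $A$ factors uniquely as $A=A^{(1)}|\cdots|A^{(d)}$ with each $A^{(j)}$ atomic; $A^!=(A^{(1)},\dots,A^{(d)})$. Over a totally ordered alphabet, a nonempty word is Lyndon if it is lexicographically strictly smaller than all of its nontrivial cyclic rotations. $A$ is a Lyndon set partition if $A^!$ is a Lyndon word in the alphabet of atomic set partitions with the fixed total order. -}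

module Defs where

open import Data.Nat using (ℕ; zero; suc; _+_; _*_; _∸_; _≤_; _%_; _≡ᵇ_)
open import Data.Bool using (Bool; true; false; if_then_else_)
open import Data.Fin using (Fin; splitAt)
open import Data.Vec using (Vec; lookup; tabulate)
open import Data.List using (List; []; _∷_; length; take; drop; _++_)
open import Data.List.Membership.Propositional using (_∈_)
open import Data.List.Relation.Unary.Unique.Propositional using (Unique)
open import Data.List.Relation.Binary.Lex.Core using (Lex-<)
open import Data.Product using (Σ; Σ-syntax; _×_; _,_; proj₁; proj₂)
open import Data.Sum using (_⊎_; inj₁; inj₂)
open import Relation.Nullary using (¬_)
open import Relation.Binary using (Rel; IsStrictTotalOrder)
open import Relation.Binary.PropositionalEquality using (_≡_)
open import Function.Bundles using (_⇔_)
open import Level using (0ℓ)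

-- Set partitions of [n], represented by their equivalence relation
-- (the relation "i and j lie in the same part") as an n×n Boolean matrix.

Matrix : ℕ → Set
Matrix n = Vec (Vec Bool n) n

rel : ∀ {n} → Matrix n → Fin n → Fin n → Bool
rel M i j = lookup (lookup M i) j

IsSetPartition : ∀ {n} → Matrix n → Set
IsSetPartition {n} M =
  ((i : Fin n) → rel M i i ≡ true) ×
  ((i j : Fin n) → rel M i j ≡ true → rel M j i ≡ true) ×
  ((i j k : Fin n) → rel M i j ≡ true → rel M j k ≡ true → rel M i k ≡ true)

_∣ₚ_ : ∀ {n k} → Matrix n → Matrix k → Matrix (n + k)
_∣ₚ_ {n} {k} A B = tabulate λ i → tabulate λ j → entry (splitAt n i) (splitAt n j)
  where
  entry : Fin n ⊎ Fin k → Fin n ⊎ Fin k → Bool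
  entry (inj₁ a) (inj₁ b) = rel A a b
  entry (inj₂ a) (inj₂ b) = rel B a b
  entry _        _        = false

SP : Set
SP = Σ ℕ Matrix

_∣ₛ_ : SP → SP → SP
(n , A) ∣ₛ (k , B) = (n + k , A ∣ₚ B)

IsAtomic : ∀ {n} → Matrix n → Set
IsAtomic {n} A =
  1 ≤ n ×
  ¬ (Σ[ k ∈ ℕ ] Σ[ l ∈ ℕ ] Σ[ B ∈ Matrix k ] Σ[ C ∈ Matrix l ]
       (1 ≤ k × 1 ≤ l × IsSetPartition B × IsSetPartition C ×
        ((k , B) ∣ₛ (l , C)) ≡ (n , A)))

Atom : Set
Atom = Σ[ n ∈ ℕ ] Σ[ A ∈ Matrix n ] (IsSetPartition A × IsAtomic A)

underlying : Atom → SP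
underlying (n , A , _) = (n , A)

_≈ₐ_ : Rel Atom 0ℓ
a ≈ₐ b = underlying a ≡ underlying b

record AtomOrder : Set₁ where
  field
    _<ₐ_ : Rel Atom 0ℓ
    isSTO : IsStrictTotalOrder _≈ₐ_ _<ₐ_

concatAtoms : List Atom → SP
concatAtoms []       = (0 , Data.Vec.[])
concatAtoms (a ∷ ws) = underlying a ∣ₛ concatAtoms ws

rotate : ∀ {A : Set} → ℕ → List A → List A
rotate i w = drop i w ++ take i w

IsLyndon : AtomOrder → List Atom → Set
IsLyndon O w =
  1 ≤ length w ×
  ((i : ℕ) → 1 ≤ i → suc i ≤ length w →
     Lex-< _≈ₐ_ (AtomOrder._<ₐ_ O) w (rotate i w))

-- A ⊢ [k] is Lyndon if A^! is a Lyndon word (by uniqueness of the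
-- atomic factorisation: some factorisation into atoms is Lyndon)
IsLyndonSP : AtomOrder → ∀ {k} → Matrix k → Set
IsLyndonSP O {k} A =
  IsSetPartition A ×
  Σ[ w ∈ List Atom ] (concatAtoms w ≡ (k , A) × IsLyndon O w)

HasCount : {X : Set} → (X → Set) → ℕ → Set
HasCount {X} P c =
  Σ[ l ∈ List X ] (Unique l × length l ≡ c × ((x : X) → (x ∈ l) ⇔ P x))

PS : Set
PS = ℕ → ℕ

sumTo : ℕ → (ℕ → ℕ) → ℕ
sumTo zero    f = f 0
sumTo (suc n) f = sumTo n f + f (suc n)

_*ₚ_ : PS → PS → PS
(f *ₚ g) n = sumTo n λ i → f i * g (n ∸ i)

oneₚ : PS
oneₚ zero    = 1
oneₚ (suc _) = 0

_^ₚ_ : PS → ℕ → PS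
f ^ₚ zero  = oneₚ
f ^ₚ suc b = f *ₚ (f ^ₚ b)

-- 1/(1 - q^(j+1)) = Σ_m q^((j+1) m)
geomInv : ℕ → PS
geomInv j m = if (m % suc j) ≡ᵇ 0 then 1 else 0

prodUpTo : (ℕ → ℕ) → ℕ → PS
prodUpTo b zero    = oneₚ
prodUpTo b (suc N) = prodUpTo b N *ₚ (geomInv N ^ₚ b (suc N))

{-# OPTIONS --safe #-}
module Submission where

-- Set partitions factor uniquely into atoms, so a set partition of [n] is a word of total size n
-- over the alphabet of atomic set partitions, and by the Chen–Fox–Lyndon theorem such a word is
-- uniquely a non-increasing product of Lyndon words. Hence set partitions of [n] correspond to
-- finite multisets of Lyndon set partitions of total size n, all of size at most N when n ≤ N.
-- Such a multiset is a vector μ of multiplicities indexed by the Lyndon set partitions L of size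
-- at most N with Σ μ_L |L| = n, and these vectors are what the coefficient of qⁿ in
-- ∏_{k ≤ N} (1 - q^k)^(-b_k) counts: one geometric series for each L.

open import Defs
open import Data.Nat using (ℕ; zero; suc; _+_; _*_; _∸_; _≤_; _<_; z≤n; s≤s; _<?_; _≤?_; _%_; _/_; _≡ᵇ_)
import Data.Nat.Properties as ℕ
open import Data.Nat.DivMod using (m≡m%n+[m/n]*n; m*n%n≡0; m*n/n≡m)
open import Data.Nat.Induction using (<-rec)
open import Data.Nat.ListAction using (sum)
open import Data.Bool using (Bool; true; false; if_then_else_; T) renaming (_≟_ to _≟ᵇ_)
open import Data.Fin using (Fin; zero; suc; splitAt; _↑ˡ_; _↑ʳ_; toℕ; fromℕ<; _≟_)
import Data.Fin.Properties as Fin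
import Data.Vec as Vec
open import Data.Vec.Properties using (lookup∘tabulate; tabulate∘lookup; tabulate-cong)
open import Data.List
  using (List; []; _∷_; _++_; length; map; replicate; take; drop; concat; concatMap; cartesianProductWith;
         tabulate; lookup; allFin; foldr)
open import Data.List.Properties
  using (++-assoc; length-++; ++-identityʳ; ∷-injective; ++-conicalˡ; ++-cancelˡ; length-take; length-drop;
         take++drop≡id; length-map; map-++; concat-++; map-tabulate; tabulate-lookup; length-tabulate)
open import Data.List.Membership.Propositional using (_∈_; _∉_; find; lose)
open import Data.List.Membership.Propositional.Properties
  using (∈-++⁺ˡ; ∈-++⁺ʳ; ∈-++⁻; ∈-∃++; ∈-map⁺; ∈-map⁻; ∈-lookup; ∈-concatMap⁺; ∈-concatMap⁻;
         ∈-cartesianProductWith⁺; ∈-cartesianProductWith⁻)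
open import Data.List.Relation.Binary.Lex.Core using (Lex-<; base; halt; this; next)
import Data.List.Relation.Binary.Lex.Strict as Lex
open import Data.List.Relation.Binary.Pointwise using (Pointwise; []; _∷_; Pointwise-length)
import Data.List.Relation.Binary.Pointwise as Pointwise
open import Data.List.Relation.Binary.Disjoint.Propositional using (Disjoint)
open import Data.List.Relation.Unary.Any using (here; there; index)
open import Data.List.Relation.Unary.Any.Properties using (lookup-index)
open import Data.List.Relation.Unary.All using (All; []; _∷_)
import Data.List.Relation.Unary.All as All
open import Data.List.Relation.Unary.All.Properties using () renaming (map⁺ to All-map⁺; ++⁺ to All-++⁺; ++⁻ to All-++⁻)
open import Data.List.Relation.Unary.AllPairs using ([]; _∷_)
import Data.List.Relation.Unary.AllPairs as AllPairs
open import Data.List.Relation.Unary.AllPairs.Properties using () renaming (map⁺ to AllPairs-map⁺)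
open import Data.List.Relation.Unary.Linked using (Linked; []; [-]; _∷_)
import Data.List.Relation.Unary.Linked as Linked
open import Data.List.Relation.Unary.Linked.Properties
  using (Linked⇒All) renaming (map⁺ to Linked-map⁺; map⁻ to Linked-map⁻)
open import Data.List.Relation.Unary.Unique.Propositional using (Unique)
import Data.List.Relation.Unary.Unique.Propositional.Properties as Unique
open import Data.Product using (Σ-syntax; _×_; _,_; proj₁; proj₂)
open import Data.Product.Properties using (Σ-≡,≡→≡; ,-injectiveʳ-UIP)
open import Data.Sum using (_⊎_; inj₁; inj₂; [_,_]′)
open import Data.Empty using (⊥-elim)
open import Function using (_∘_; id; flip)
open import Function.Bundles using (Equivalence; _⇔_)
open import Level using (_⊔_)
open import Relation.Nullary using (¬_; Dec; yes; no; does)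
open import Relation.Nullary.Decidable using (_→-dec_; map′)
open import Relation.Unary using (Decidable)
open import Relation.Binary using (Rel; IsStrictTotalOrder; tri<; tri≈; tri>)
open import Relation.Binary.PropositionalEquality
  using (_≡_; _≢_; refl; sym; trans; cong; cong₂; subst; module ≡-Reasoning)
open import Algebra.Properties.CommutativeSemigroup ℕ.+-commutativeSemigroup using (x∙yz≈y∙xz)
open import Algebra.Properties.CommutativeMonoid.Sum ℕ.+-0-commutativeMonoid
  using (sum-syntax; ∑-distrib-+; sum-cong-≗; sum-replicate-zero)

module _ {a} {A : Set a} where

  drop-length-++ : (u v : List A) → drop (length u) (u ++ v) ≡ v
  drop-length-++ []      v = refl
  drop-length-++ (x ∷ u) v = drop-length-++ u v

  take-length-++ : (u v : List A) → take (length u) (u ++ v) ≡ u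
  take-length-++ []      v = refl
  take-length-++ (x ∷ u) v = cong (x ∷_) (take-length-++ u v)

  length-take-≤ : ∀ n (xs : List A) → n ≤ length xs → length (take n xs) ≡ n
  length-take-≤ zero    xs       _         = refl
  length-take-≤ (suc n) (x ∷ xs) (s≤s n≤) = cong suc (length-take-≤ n xs n≤)

  drop-++-≤ : ∀ i (u v : List A) → i ≤ length u → drop i (u ++ v) ≡ drop i u ++ v
  drop-++-≤ zero    u       v _         = refl
  drop-++-≤ (suc i) (x ∷ u) v (s≤s i≤) = drop-++-≤ i u v i≤

  drop-++-≥ : ∀ i (u v : List A) → length u ≤ i → drop i (u ++ v) ≡ drop (i ∸ length u) v
  drop-++-≥ i       []      v _         = refl
  drop-++-≥ (suc i) (x ∷ u) v (s≤s ≤i) = drop-++-≥ i u v ≤i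

  nonEmpty⇒length≥1 : ∀ {xs : List A} → xs ≢ [] → 1 ≤ length xs
  nonEmpty⇒length≥1 {[]}    xs≢[] = ⊥-elim (xs≢[] refl)
  nonEmpty⇒length≥1 {_ ∷ _} _     = s≤s z≤n

  ++-overlap : ∀ (q r g h : List A) → q ++ r ≡ g ++ h →
               (Σ[ r′ ∈ List A ] g ≡ q ++ r′) ⊎
               (Σ[ q′ ∈ List A ] (q ≡ g ++ q′ × q′ ≢ [] × q′ ++ r ≡ h))
  ++-overlap []      r g       h eq = inj₁ (g , refl)
  ++-overlap (x ∷ q) r []      h eq = inj₂ (x ∷ q , refl , (λ ()) , eq)
  ++-overlap (x ∷ q) r (y ∷ g) h eq with ∷-injective eq
  ... | refl , eq′ with ++-overlap q r g h eq′
  ...   | inj₁ (r′ , g≡qr′)               = inj₁ (r′ , cong (x ∷_) g≡qr′)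
  ...   | inj₂ (q′ , q≡gq′ , q′≢[] , eq″) = inj₂ (q′ , cong (x ∷_) q≡gq′ , q′≢[] , eq″)

  ++-cancel-sameLength : ∀ (x x′ : List A) {y y′} → length x ≡ length x′ →
                         x ++ y ≡ x′ ++ y′ → x ≡ x′ × y ≡ y′
  ++-cancel-sameLength []      []       _    eq = refl , eq
  ++-cancel-sameLength (a ∷ x) (b ∷ x′) |x|≡ eq with ∷-injective eq
  ... | refl , eq′ with ++-cancel-sameLength x x′ (ℕ.suc-injective |x|≡) eq′
  ...   | refl , y≡y′ = refl , y≡y′

  ++-product-unique : ∀ {m} (xs ys : List (List A)) → All (λ x → length x ≡ m) xs →
                      Unique xs → Unique ys → Unique (cartesianProductWith _++_ xs ys)
  ++-product-unique []       ys _ _ _ = []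
  ++-product-unique (x ∷ xs) ys (|x|≡m ∷ |xs|≡m) (x∉xs ∷ xs-unique) ys-unique =
    Unique.++⁺ (Unique.map⁺ (++-cancelˡ x _ _) ys-unique) (++-product-unique xs ys |xs|≡m xs-unique ys-unique)
      disjoint
    where
    disjoint : Disjoint (map (x ++_) ys) (cartesianProductWith _++_ xs ys)
    disjoint (z∈x++ys , z∈xs++ys) =
      let _ , _ , z≡xy = ∈-map⁻ (x ++_) z∈x++ys
          x′ , _ , x′∈xs , _ , z≡x′y′ = ∈-cartesianProductWith⁻ _++_ xs ys z∈xs++ys
          |x|≡|x′| = trans |x|≡m (sym (All.lookup |xs|≡m x′∈xs))
      in All.lookup x∉xs x′∈xs (proj₁ (++-cancel-sameLength x x′ |x|≡|x′| (trans (sym z≡xy) z≡x′y′)))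

  lookup-injective : ∀ {xs : List A} → Unique xs → ∀ i j → lookup xs i ≡ lookup xs j → i ≡ j
  lookup-injective {_ ∷ _} _          zero    zero    _  = refl
  lookup-injective {_ ∷ _} (x∉xs ∷ _) zero    (suc j) x≡ = ⊥-elim (All.lookup x∉xs (∈-lookup j) x≡)
  lookup-injective {_ ∷ _} (x∉xs ∷ _) (suc i) zero    ≡x = ⊥-elim (All.lookup x∉xs (∈-lookup i) (sym ≡x))
  lookup-injective {_ ∷ _} (_ ∷ uniq) (suc i) (suc j) eq = cong suc (lookup-injective uniq i j eq)

  Unique-drop-mid : ∀ (pre : List A) {y} post → Unique (pre ++ y ∷ post) →
                    Unique (pre ++ post) × y ∉ pre ++ post
  Unique-drop-mid []        post (y∉post ∷ post-unique) =
    post-unique , λ y∈post → All.lookup y∉post y∈post refl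
  Unique-drop-mid (x ∷ pre) post (x∉ ∷ rest-unique) with All-++⁻ pre x∉
  ... | x∉pre , _ ∷ x∉post =
    let rest-unique′ , y∉rest = Unique-drop-mid pre post rest-unique
    in All-++⁺ x∉pre x∉post ∷ rest-unique′ ,
       λ { (here refl) → All.lookup x∉ (∈-++⁺ʳ pre (here refl)) refl ; (there y∈rest) → y∉rest y∈rest }

  ∈-drop-mid⁻ : ∀ (pre : List A) {y} post {z} → z ∈ pre ++ y ∷ post → z ≡ y ⊎ z ∈ pre ++ post
  ∈-drop-mid⁻ pre post z∈ with ∈-++⁻ pre z∈
  ... | inj₁ z∈pre          = inj₂ (∈-++⁺ˡ z∈pre)
  ... | inj₂ (here refl)    = inj₁ refl
  ... | inj₂ (there z∈post) = inj₂ (∈-++⁺ʳ pre z∈post)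

  ∈-drop-mid⁺ : ∀ (pre : List A) {y} post {z} → z ∈ pre ++ post → z ∈ pre ++ y ∷ post
  ∈-drop-mid⁺ pre post z∈ with ∈-++⁻ pre z∈
  ... | inj₁ z∈pre  = ∈-++⁺ˡ z∈pre
  ... | inj₂ z∈post = ∈-++⁺ʳ pre (there z∈post)

concatMap-unique : ∀ {a b} {A : Set a} {B : Set b} (H : A → List B) {xs} → (∀ x → Unique (H x)) →
                   (∀ {x x′} → x ≢ x′ → Disjoint (H x) (H x′)) → Unique xs → Unique (concatMap H xs)
concatMap-unique H H-unique H-disjoint xs-unique =
  Unique.concat⁺ (All-map⁺ (All.universal H-unique _)) (AllPairs-map⁺ (AllPairs.map H-disjoint xs-unique))

length-cartesianProductWith : ∀ {a b c} {A : Set a} {B : Set b} {C : Set c} (f : A → B → C) xs ys →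
                              length (cartesianProductWith f xs ys) ≡ length xs * length ys
length-cartesianProductWith f []       ys = refl
length-cartesianProductWith f (x ∷ xs) ys =
  trans (length-++ (map (f x) ys)) (cong₂ _+_ (length-map (f x) ys) (length-cartesianProductWith f xs ys))

module _ {a b r} {X : Set a} {Y : Set b} (R : X → Y → Set r)
         (R-injective : ∀ {x x′ y} → R x y → R x′ y → x ≡ x′)
         (R-functional : ∀ {x y y′} → R x y → R x y′ → y ≡ y′) where

  bijection⇒length≡ : ∀ xs ys → Unique xs → Unique ys →
                      (∀ {x} → x ∈ xs → Σ[ y ∈ Y ] (y ∈ ys × R x y)) →
                      (∀ {y} → y ∈ ys → Σ[ x ∈ X ] (x ∈ xs × R x y)) → length xs ≡ length ys
  bijection⇒length≡ []       []       _ _ _ _ = refl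
  bijection⇒length≡ []       (y ∷ ys) _ _ _ from with from (here refl)
  ... | _ , () , _
  bijection⇒length≡ (x ∷ xs) ys (x∉xs ∷ xs-unique) ys-unique to from with to (here refl)
  ... | y , y∈ys , Rxy with ∈-∃++ y∈ys
  ...   | pre , post , refl = begin
    suc (length xs)                ≡⟨ cong suc (bijection⇒length≡ xs _ xs-unique ys′-unique to′ from′) ⟩
    suc (length (pre ++ post))     ≡⟨ cong suc (length-++ pre) ⟩
    suc (length pre + length post) ≡⟨ ℕ.+-suc (length pre) (length post) ⟨
    length pre + length (y ∷ post) ≡⟨ length-++ pre ⟨
    length (pre ++ y ∷ post)       ∎
    where
    open ≡-Reasoning
    ys′-unique = proj₁ (Unique-drop-mid pre post ys-unique)
    y∉ys′ = proj₂ (Unique-drop-mid pre post ys-unique)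
    to′ : ∀ {x′} → x′ ∈ xs → Σ[ y′ ∈ Y ] (y′ ∈ pre ++ post × R x′ y′)
    to′ {x′} x′∈xs = drop-y (to (there x′∈xs))
      where
      drop-y : Σ[ y′ ∈ Y ] (y′ ∈ pre ++ y ∷ post × R x′ y′) →
               Σ[ y′ ∈ Y ] (y′ ∈ pre ++ post × R x′ y′)
      drop-y (y′ , y′∈ys , Rx′y′) =
        [ (λ y′≡y → ⊥-elim (All.lookup x∉xs x′∈xs (R-injective Rxy (subst (R x′) y′≡y Rx′y′))))
        , (λ y′∈ys′ → y′ , y′∈ys′ , Rx′y′) ]′ (∈-drop-mid⁻ pre post y′∈ys)
    from′ : ∀ {y′} → y′ ∈ pre ++ post → Σ[ x′ ∈ X ] (x′ ∈ xs × R x′ y′)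
    from′ y′∈ys′ with from (∈-drop-mid⁺ pre post y′∈ys′)
    ... | _ , here refl , Rxy′      =
      ⊥-elim (y∉ys′ (subst (_∈ pre ++ post) (R-functional Rxy′ Rxy) y′∈ys′))
    ... | x′ , there x′∈xs , Rx′y′ = x′ , x′∈xs , Rx′y′

least : ∀ {P : ℕ → Set} → Decidable P → ∀ m → P m →
        Σ[ j ∈ ℕ ] (j ≤ m × P j × (∀ {k} → k < j → ¬ P k))
least P? m Pm with P? 0
... | yes P0 = 0 , z≤n , P0 , λ ()
least P? zero    P0 | no ¬P0 = ⊥-elim (¬P0 P0)
least P? (suc m) Pm | no ¬P0 =
  let j , j≤m , Pj , ¬P<j = least (P? ∘ suc) m Pm
  in suc j , s≤s j≤m , Pj , λ { {zero} _ → ¬P0 ; {suc k} (s≤s k<j) → ¬P<j k<j }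

-- Lyndon words

module LyndonWords {ℓ₁ ℓ₂} {X : Set} {_≈_ : Rel X ℓ₁} {_≺_ : Rel X ℓ₂}
                   (isSTO : IsStrictTotalOrder _≈_ _≺_) where

  private
    module X = IsStrictTotalOrder isSTO

  _≋_ : Rel (List X) ℓ₁
  _≋_ = Pointwise _≈_

  _⊏_ : Rel (List X) (ℓ₁ ⊔ ℓ₂)
  _⊏_ = Lex-< _≈_ _≺_

  _⊑_ : Rel (List X) (ℓ₁ ⊔ ℓ₂)
  x ⊑ y = ¬ (y ⊏ x)

  open IsStrictTotalOrder (Lex.<-isStrictTotalOrder isSTO) public
    using (compare)
    renaming (trans to ⊏-trans; irrefl to ⊏-irrefl; asym to ⊏-asym;
              <-respˡ-≈ to ⊏-respˡ-≋; <-respʳ-≈ to ⊏-respʳ-≋; module Eq to ≋)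

  ⊑-refl : ∀ {x} → x ⊑ x
  ⊑-refl = ⊏-irrefl ≋.refl

  ⊏-⊑-trans : ∀ {x y z} → x ⊏ y → y ⊑ z → x ⊏ z
  ⊏-⊑-trans {x} {y} {z} x⊏y y⊑z with compare x z
  ... | tri< x⊏z _   _   = x⊏z
  ... | tri≈ _   x≋z _   = ⊥-elim (y⊑z (⊏-respˡ-≋ x≋z x⊏y))
  ... | tri> _   _   z⊏x = ⊥-elim (y⊑z (⊏-trans z⊏x x⊏y))

  ⊑-trans : ∀ {x y z} → x ⊑ y → y ⊑ z → x ⊑ z
  ⊑-trans x⊑y y⊑z z⊏x = y⊑z (⊏-⊑-trans z⊏x x⊑y)

  -- x ≪ y: x ⊏ y is decided at a position where both words have a letter,
  -- so it survives appending arbitrary words to either side.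
  data _≪_ : List X → List X → Set (ℓ₁ ⊔ ℓ₂) where
    here  : ∀ {x y xs ys} → x ≺ y → (x ∷ xs) ≪ (y ∷ ys)
    there : ∀ {x y xs ys} → x ≈ y → xs ≪ ys → (x ∷ xs) ≪ (y ∷ ys)

  ≪⇒⊏ : ∀ {x y} → x ≪ y → x ⊏ y
  ≪⇒⊏ (here x≺y)       = this x≺y
  ≪⇒⊏ (there x≈y x≪y) = next x≈y (≪⇒⊏ x≪y)

  ≪-++ : ∀ {x y} u v → x ≪ y → (x ++ u) ≪ (y ++ v)
  ≪-++ u v (here x≺y)       = here x≺y
  ≪-++ u v (there x≈y x≪y) = there x≈y (≪-++ u v x≪y)

  ≪-++ʳ : ∀ {x y} v → x ≪ y → x ≪ (y ++ v)
  ≪-++ʳ {x} v x≪y = subst (_≪ _) (++-identityʳ x) (≪-++ [] v x≪y)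

  ≪-++ˡ : ∀ {x y} u → x ≪ y → (x ++ u) ≪ y
  ≪-++ˡ {y = y} u x≪y = subst (_ ≪_) (++-identityʳ y) (≪-++ u [] x≪y)

  ⊏⇒≪⊎proper-prefix : ∀ {x y} → x ⊏ y → x ≪ y ⊎ Σ[ t ∈ List X ] (t ≢ [] × y ≋ (x ++ t))
  ⊏⇒≪⊎proper-prefix (base ())
  ⊏⇒≪⊎proper-prefix (halt {y} {ys}) = inj₂ (y ∷ ys , (λ ()) , ≋.refl)
  ⊏⇒≪⊎proper-prefix (this x≺y)      = inj₁ (here x≺y)
  ⊏⇒≪⊎proper-prefix (next x≈y xs⊏ys) with ⊏⇒≪⊎proper-prefix xs⊏ys
  ... | inj₁ xs≪ys            = inj₁ (there x≈y xs≪ys)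
  ... | inj₂ (t , t≢[] , ys≋) = inj₂ (t , t≢[] , X.Eq.sym x≈y ∷ ys≋)

  ⊏⇒≪ : ∀ {x y} → x ⊏ y → length y ≤ length x → x ≪ y
  ⊏⇒≪ {x} x⊏y |y|≤|x| with ⊏⇒≪⊎proper-prefix x⊏y
  ... | inj₁ x≪y              = x≪y
  ... | inj₂ (t , t≢[] , y≋) = ⊥-elim (ℕ.<⇒≱ |x|<|y| |y|≤|x|)
    where
    |x|<|y| : length x < _
    |x|<|y| = subst (length x <_)
      (sym (trans (Pointwise-length y≋) (length-++ x)))
      (ℕ.m<m+n (length x) (nonEmpty⇒length≥1 t≢[]))

  ++-monoʳ-⊏ : ∀ p {x y} → x ⊏ y → (p ++ x) ⊏ (p ++ y)
  ++-monoʳ-⊏ []      x⊏y = x⊏y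
  ++-monoʳ-⊏ (_ ∷ p) x⊏y = next X.Eq.refl (++-monoʳ-⊏ p x⊏y)

  ++-cancelˡ-⊏ : ∀ p {x y} → (p ++ x) ⊏ (p ++ y) → x ⊏ y
  ++-cancelˡ-⊏ []      x⊏y           = x⊏y
  ++-cancelˡ-⊏ (_ ∷ p) (this a≺a)    = ⊥-elim (X.irrefl X.Eq.refl a≺a)
  ++-cancelˡ-⊏ (_ ∷ p) (next _ p⊏p) = ++-cancelˡ-⊏ p p⊏p

  ⊏-++-sameLength : ∀ u v {x y} → length u ≡ length v → (u ++ x) ⊏ (v ++ y) → u ⊏ v ⊎ (u ≋ v × x ⊏ y)
  ⊏-++-sameLength []      []      _ x⊏y = inj₂ ([] , x⊏y)
  ⊏-++-sameLength (_ ∷ u) (_ ∷ v) _ (this a≺b) = inj₁ (this a≺b)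
  ⊏-++-sameLength (_ ∷ u) (_ ∷ v) |u|≡|v| (next a≈b ux⊏vy)
    with ⊏-++-sameLength u v (ℕ.suc-injective |u|≡|v|) ux⊏vy
  ... | inj₁ u⊏v         = inj₁ (next a≈b u⊏v)
  ... | inj₂ (u≋v , x⊏y) = inj₂ (a≈b ∷ u≋v , x⊏y)

  ≋-++-sameLength : ∀ u v {x y} → length u ≡ length v → (u ++ x) ≋ (v ++ y) → u ≋ v × x ≋ y
  ≋-++-sameLength []      []      _ x≋y = [] , x≋y
  ≋-++-sameLength (_ ∷ u) (_ ∷ v) |u|≡|v| (a≈b ∷ ux≋vy)
    with ≋-++-sameLength u v (ℕ.suc-injective |u|≡|v|) ux≋vy
  ... | u≋v , x≋y = a≈b ∷ u≋v , x≋y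

  ⊑-++ : ∀ x u → x ⊑ (x ++ u)
  ⊑-++ []      u (base ())
  ⊑-++ (_ ∷ x) u (this a≺a) = X.irrefl X.Eq.refl a≺a
  ⊑-++ (_ ∷ x) u (next _ xu⊏x) = ⊑-++ x u xu⊏x

  ≋-take : ∀ n {xs ys} → xs ≋ ys → take n xs ≋ take n ys
  ≋-take zero    _          = []
  ≋-take (suc n) []         = []
  ≋-take (suc n) (x≈y ∷ ≋) = x≈y ∷ ≋-take n ≋

  ≋-drop : ∀ n {xs ys} → xs ≋ ys → drop n xs ≋ drop n ys
  ≋-drop zero    ≋          = ≋
  ≋-drop (suc n) []         = []
  ≋-drop (suc n) (_ ∷ ≋) = ≋-drop n ≋

  Lyndon : List X → Set (ℓ₁ ⊔ ℓ₂)
  Lyndon w = 1 ≤ length w × (∀ i → 1 ≤ i → suc i ≤ length w → w ⊏ drop i w)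

  LyndonByRotation : List X → Set (ℓ₁ ⊔ ℓ₂)
  LyndonByRotation w = 1 ≤ length w × (∀ i → 1 ≤ i → suc i ≤ length w → w ⊏ rotate i w)

  lyndon⇒byRotation : ∀ {w} → Lyndon w → LyndonByRotation w
  lyndon⇒byRotation {w} (|w|≥1 , w⊏drop) = |w|≥1 , λ i 1≤i i<|w| →
    ≪⇒⊏ (≪-++ʳ (take i w) (⊏⇒≪ (w⊏drop i 1≤i i<|w|) (|drop|≤|w| i)))
    where
    |drop|≤|w| : ∀ i → length (drop i w) ≤ length w
    |drop|≤|w| i = subst (_≤ length w) (sym (length-drop i w)) (ℕ.m∸n≤m (length w) i)

  border-⊏-rotations : ∀ u s t → length u ≡ length t → (u ++ s) ≋ (s ++ t) →
                       (u ++ s) ⊏ (s ++ u) → ¬ ((u ++ s) ⊏ (t ++ s))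
  border-⊏-rotations u s t |u|≡|t| us≋st us⊏su us⊏ts
    with ⊏-++-sameLength u t |u|≡|t| us⊏ts
  ... | inj₁ u⊏t      = ⊏-asym u⊏t (++-cancelˡ-⊏ s (⊏-respˡ-≋ us≋st us⊏su))
  ... | inj₂ (_ , s⊏s) = ⊏-irrefl ≋.refl s⊏s

  -- A proper suffix s = drop i w with s ⊏ w either differs from w at a letter of s,
  -- contradicting w ⊏ s ++ take i w, or is a border of w, excluded by border-⊏-rotations.
  byRotation⇒lyndon : ∀ {w} → LyndonByRotation w → Lyndon w
  byRotation⇒lyndon {w} (|w|≥1 , w⊏rotate) = |w|≥1 , w⊏drop
    where
    w⊏drop : ∀ i → 1 ≤ i → suc i ≤ length w → w ⊏ drop i w
    w⊏drop i 1≤i i<|w| with compare w (drop i w)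
    ... | tri< w⊏s _ _ = w⊏s
    ... | tri≈ _ w≋s _ = ⊥-elim (ℕ.<-irrefl (sym (trans (Pointwise-length w≋s) (length-drop i w)))
                                              (ℕ.∸-monoʳ-< 1≤i (ℕ.<⇒≤ i<|w|)))
    ... | tri> _ _ s⊏w with ⊏⇒≪⊎proper-prefix s⊏w
    ...   | inj₁ s≪w = ⊥-elim (⊏-asym (w⊏rotate i 1≤i i<|w|) (≪⇒⊏ (≪-++ˡ (take i w) s≪w)))
    ...   | inj₂ (t , _ , w≋st) = ⊥-elim (
      border-⊏-rotations u s t (trans |u|≡i (sym |t|≡i)) us≋st
        (subst (_⊏ (s ++ u)) w≡us (w⊏rotate i 1≤i i<|w|))
        (subst (_⊏ (t ++ s)) w≡us (⊏-respʳ-≋ rotate-j≋ts (w⊏rotate j 1≤j j<|w|))))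
      where
      u = take i w
      s = drop i w
      j = length s
      open ≡-Reasoning
      w≡us : w ≡ u ++ s
      w≡us = sym (take++drop≡id i w)
      us≋st : (u ++ s) ≋ (s ++ t)
      us≋st = subst (_≋ (s ++ t)) w≡us w≋st
      |s|≡ : j ≡ length w ∸ i
      |s|≡ = length-drop i w
      |u|≡i : length u ≡ i
      |u|≡i = length-take-≤ i w (ℕ.<⇒≤ i<|w|)
      |t|≡i : length t ≡ i
      |t|≡i = ℕ.+-cancelˡ-≡ j _ _ (begin
        j + length t     ≡⟨ length-++ s ⟨
        length (s ++ t)  ≡⟨ Pointwise-length w≋st ⟨
        length w         ≡⟨ ℕ.m∸n+n≡m (ℕ.<⇒≤ i<|w|) ⟨
        length w ∸ i + i ≡⟨ cong (_+ i) |s|≡ ⟨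
        j + i            ∎)
      1≤j : 1 ≤ j
      1≤j = subst (1 ≤_) (sym |s|≡) (ℕ.m<n⇒0<n∸m i<|w|)
      j<|w| : suc j ≤ length w
      j<|w| = subst (λ k → suc k ≤ length w) (sym |s|≡) (ℕ.∸-monoʳ-< 1≤i (ℕ.<⇒≤ i<|w|))
      rotate-j≋ts : rotate j w ≋ (t ++ s)
      rotate-j≋ts = Pointwise.++⁺ (subst (drop j w ≋_) (drop-length-++ s t) (≋-drop j w≋st))
                                  (subst (take j w ≋_) (take-length-++ s t) (≋-take j w≋st))

  Lyndon-resp-≋ : ∀ {w w′} → w ≋ w′ → Lyndon w → Lyndon w′
  Lyndon-resp-≋ w≋w′ (|w|≥1 , w⊏drop) =
    subst (1 ≤_) |w|≡|w′| |w|≥1 ,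
    λ i 1≤i i<|w′| → ⊏-respˡ-≋ w≋w′ (⊏-respʳ-≋ (≋-drop i w≋w′)
                       (w⊏drop i 1≤i (subst (suc i ≤_) (sym |w|≡|w′|) i<|w′|)))
    where |w|≡|w′| = Pointwise-length w≋w′

  Lyndon⇒nonEmpty : ∀ {w} → Lyndon w → w ≢ []
  Lyndon⇒nonEmpty {[]}    (() , _)
  Lyndon⇒nonEmpty {_ ∷ _} _ ()

  Lyndon-[_] : ∀ x → Lyndon (x ∷ [])
  Lyndon-[ x ] = s≤s z≤n , λ { (suc i) _ (s≤s ()) }

  Lyndon⇒⊏-suffix : ∀ {u s} → Lyndon (u ++ s) → u ≢ [] → s ≢ [] → (u ++ s) ⊏ s
  Lyndon⇒⊏-suffix {u} {s} (_ , w⊏drop) u≢[] s≢[] =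
    subst ((u ++ s) ⊏_) (drop-length-++ u s) (w⊏drop (length u) (nonEmpty⇒length≥1 u≢[]) |u|<|us|)
    where
    |u|<|us| : suc (length u) ≤ length (u ++ s)
    |u|<|us| = subst (suc (length u) ≤_) (sym (length-++ u))
                 (subst (_≤ length u + length s) (ℕ.+-comm (length u) 1)
                   (ℕ.+-monoʳ-≤ (length u) (nonEmpty⇒length≥1 s≢[])))

  ++-⊏-Lyndon : ∀ {c l} → 1 ≤ length c → Lyndon l → c ⊏ l → (c ++ l) ⊏ l
  ++-⊏-Lyndon {c} {l} |c|≥1 (_ , l⊏drop) c⊏l with ⊏⇒≪⊎proper-prefix c⊏l
  ... | inj₁ c≪l              = ≪⇒⊏ (≪-++ˡ l c≪l)
  ... | inj₂ (t , t≢[] , l≋ct) = ⊏-respʳ-≋ (≋.sym l≋ct) (++-monoʳ-⊏ c l⊏t)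
    where
    |l|≡ : length l ≡ length c + length t
    |l|≡ = trans (Pointwise-length l≋ct) (length-++ c)
    |c|<|l| : suc (length c) ≤ length l
    |c|<|l| = subst (suc (length c) ≤_) (sym |l|≡)
               (subst (_≤ length c + length t) (ℕ.+-comm (length c) 1)
                 (ℕ.+-monoʳ-≤ (length c) (nonEmpty⇒length≥1 t≢[])))
    l⊏t : l ⊏ t
    l⊏t = subst (l ⊏_) (drop-length-++ c t)
            (⊏-respʳ-≋ (≋-drop (length c) l≋ct) (l⊏drop (length c) |c|≥1 |c|<|l|))

  Lyndon-++ : ∀ {c l} → Lyndon c → Lyndon l → c ⊏ l → Lyndon (c ++ l)
  Lyndon-++ {c} {l} (|c|≥1 , c⊏drop) Lyndon-l@(_ , l⊏drop) c⊏l = |cl|≥1 , cl⊏drop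
    where
    |cl|≥1 : 1 ≤ length (c ++ l)
    |cl|≥1 = subst (1 ≤_) (sym (length-++ c)) (ℕ.≤-trans |c|≥1 (ℕ.m≤m+n (length c) (length l)))
    cl⊏l : (c ++ l) ⊏ l
    cl⊏l = ++-⊏-Lyndon |c|≥1 Lyndon-l c⊏l
    cl⊏drop : ∀ i → 1 ≤ i → suc i ≤ length (c ++ l) → (c ++ l) ⊏ drop i (c ++ l)
    cl⊏drop i 1≤i i<|cl| with ℕ.<-cmp i (length c)
    ... | tri< i<|c| _ _ = subst ((c ++ l) ⊏_) (sym (drop-++-≤ i c l (ℕ.<⇒≤ i<|c|)))
            (≪⇒⊏ (≪-++ l l (⊏⇒≪ (c⊏drop i 1≤i i<|c|)
              (subst (_≤ length c) (sym (length-drop i c)) (ℕ.m∸n≤m (length c) i)))))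
    ... | tri≈ _ refl _ = subst ((c ++ l) ⊏_) (sym (drop-length-++ c l)) cl⊏l
    ... | tri> _ _ |c|<i = subst ((c ++ l) ⊏_) (sym (drop-++-≥ i c l (ℕ.<⇒≤ |c|<i)))
            (⊏-trans cl⊏l (l⊏drop (i ∸ length c) (ℕ.m<n⇒0<n∸m |c|<i) i-|c|<|l|))
      where
      i-|c|<|l| : suc (i ∸ length c) ≤ length l
      i-|c|<|l| = subst (_≤ length l) (ℕ.+-∸-assoc 1 (ℕ.<⇒≤ |c|<i))
        (ℕ.≤-trans (ℕ.∸-monoˡ-≤ (length c) (subst (suc i ≤_) (length-++ c) i<|cl|))
                   (ℕ.≤-reflexive (ℕ.m+n∸m≡n (length c) (length l))))

  NonIncreasing : List (List X) → Set (ℓ₁ ⊔ ℓ₂)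
  NonIncreasing = Linked (flip _⊑_)

  NonIncreasing⇒⊑-head : ∀ {f fs} → NonIncreasing (f ∷ fs) → All (_⊑ f) fs
  NonIncreasing⇒⊑-head [-]            = []
  NonIncreasing⇒⊑-head (g⊑f ∷ g∷gs↘) = Linked⇒All (flip ⊑-trans) g⊑f g∷gs↘

  NonIncreasing-resp : ∀ {fs gs} → Pointwise _≋_ fs gs → NonIncreasing gs → NonIncreasing fs
  NonIncreasing-resp []                 []             = []
  NonIncreasing-resp (_ ∷ [])           [-]            = [-]
  NonIncreasing-resp (f≋f′ ∷ g≋g′ ∷ ≋s) (g′⊑f′ ∷ g′∷↘) =
    (λ f⊏g → g′⊑f′ (⊏-respˡ-≋ f≋f′ (⊏-respʳ-≋ g≋g′ f⊏g))) ∷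
    NonIncreasing-resp (g≋g′ ∷ ≋s) g′∷↘

  record LyndonFactorisation (w : List X) : Set (ℓ₁ ⊔ ℓ₂) where
    constructor factorisation
    field
      factors        : List (List X)
      allLyndon      : All Lyndon factors
      nonIncreasing  : NonIncreasing factors
      concat-factors : concat factors ≡ w

  prependLyndon : ∀ {c} fs → Lyndon c → All Lyndon fs → NonIncreasing fs →
                  LyndonFactorisation (c ++ concat fs)
  prependLyndon {c} [] Lyndon-c [] [] = factorisation (c ∷ []) (Lyndon-c ∷ []) [-] refl
  prependLyndon {c} (f ∷ fs) Lyndon-c (Lyndon-f ∷ Lyndon-fs) f∷fs↘ with compare c f
  ... | tri< c⊏f _ _ =
    let factorisation gs Lyndon-gs gs↘ eq =
          prependLyndon fs (Lyndon-++ Lyndon-c Lyndon-f c⊏f) Lyndon-fs (Linked.tail f∷fs↘)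
    in factorisation gs Lyndon-gs gs↘ (trans eq (++-assoc c f (concat fs)))
  ... | tri≈ f⊑c _ _ = factorisation (c ∷ f ∷ fs) (Lyndon-c ∷ Lyndon-f ∷ Lyndon-fs) (f⊑c ∷ f∷fs↘) refl
  ... | tri> f⊑c _ _ = factorisation (c ∷ f ∷ fs) (Lyndon-c ∷ Lyndon-f ∷ Lyndon-fs) (f⊑c ∷ f∷fs↘) refl

  lyndonFactorisation : ∀ w → LyndonFactorisation w
  lyndonFactorisation []      = factorisation [] [] [] refl
  lyndonFactorisation (x ∷ w) =
    let factorisation fs Lyndon-fs fs↘ eq = lyndonFactorisation w
        factorisation gs Lyndon-gs gs↘ eq′ = prependLyndon fs Lyndon-[ x ] Lyndon-fs fs↘
    in factorisation gs Lyndon-gs gs↘ (trans eq′ (cong (x ∷_) eq))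

  prefix-ends-⊑ : ∀ {f} gs q r → All (_⊑ f) gs → q ≢ [] → q ++ r ≡ concat gs →
                  Σ[ t ∈ List X ] Σ[ s ∈ List X ] (q ≡ t ++ s × s ≢ [] × s ⊑ f)
  prefix-ends-⊑ []       []      r _ q≢[] _ = ⊥-elim (q≢[] refl)
  prefix-ends-⊑ (g ∷ gs) q       r (g⊑f ∷ gs⊑f) q≢[] eq with ++-overlap q r g (concat gs) eq
  ... | inj₁ (r′ , g≡qr′) = [] , q , refl , q≢[] , ⊑-trans (subst (q ⊑_) (sym g≡qr′) (⊑-++ q r′)) g⊑f
  ... | inj₂ (q′ , q≡gq′ , q′≢[] , eq′) =
    let t , s , q′≡ts , s≢[] , s⊑f = prefix-ends-⊑ gs q′ r gs⊑f q′≢[] eq′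
    in g ++ t , s , trans q≡gq′ (trans (cong (g ++_) q′≡ts) (sym (++-assoc g t s))) , s≢[] , s⊑f

  lyndonPrefix⇒prefix-of-head : ∀ {f fs p r} → Lyndon f → NonIncreasing (f ∷ fs) → Lyndon p →
                                 p ++ r ≡ f ++ concat fs → Σ[ r′ ∈ List X ] f ≡ p ++ r′
  lyndonPrefix⇒prefix-of-head {f} {fs} {p} {r} Lyndon-f f∷fs↘ Lyndon-p eq
    with ++-overlap p r f (concat fs) eq
  ... | inj₁ f≡pr′ = f≡pr′
  ... | inj₂ (q′ , p≡fq′ , q′≢[] , eq′) =
    let t , s , q′≡ts , s≢[] , s⊑f = prefix-ends-⊑ fs q′ r (NonIncreasing⇒⊑-head f∷fs↘) q′≢[] eq′
        p≡fts : p ≡ (f ++ t) ++ s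
        p≡fts = trans p≡fq′ (trans (cong (f ++_) q′≡ts) (sym (++-assoc f t s)))
        ft≢[] : f ++ t ≢ []
        ft≢[] eq = Lyndon⇒nonEmpty Lyndon-f (++-conicalˡ f t eq)
        p⊏s : p ⊏ s
        p⊏s = subst (_⊏ s) (sym p≡fts) (Lyndon⇒⊏-suffix (subst Lyndon p≡fts Lyndon-p) ft≢[] s≢[])
    in ⊥-elim (⊑-++ f q′ (subst (_⊏ f) p≡fq′ (⊏-⊑-trans p⊏s s⊑f)))

  head-length-≤ : ∀ {f fs g gs} → Lyndon f → NonIncreasing (f ∷ fs) → Lyndon g →
                  (f ++ concat fs) ≋ (g ++ concat gs) → length g ≤ length f
  head-length-≤ {f} {fs} {g} {gs} Lyndon-f f∷fs↘ Lyndon-g w≋ =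
    let r′ , f≡pr′ = lyndonPrefix⇒prefix-of-head Lyndon-f f∷fs↘ (Lyndon-resp-≋ (≋.sym p≋g) Lyndon-g)
                       (take++drop≡id (length g) w)
    in begin
      length g         ≡⟨ Pointwise-length p≋g ⟨
      length p         ≤⟨ ℕ.m≤m+n (length p) (length r′) ⟩
      length p + length r′ ≡⟨ length-++ p ⟨
      length (p ++ r′) ≡⟨ cong length f≡pr′ ⟨
      length f         ∎
    where
    open ℕ.≤-Reasoning
    w = f ++ concat fs
    p = take (length g) w
    p≋g : p ≋ g
    p≋g = subst (p ≋_) (take-length-++ g (concat gs)) (≋-take (length g) w≋)

  factorisation-unique : ∀ fs gs → All Lyndon fs → NonIncreasing fs → All Lyndon gs → NonIncreasing gs →
                         concat fs ≋ concat gs → Pointwise _≋_ fs gs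
  factorisation-unique [] [] _ _ _ _ _ = []
  factorisation-unique [] ([] ∷ gs) _ _ (Lyndon-g ∷ _) _ _ = ⊥-elim (Lyndon⇒nonEmpty Lyndon-g refl)
  factorisation-unique ([] ∷ fs) [] (Lyndon-f ∷ _) _ _ _ _ = ⊥-elim (Lyndon⇒nonEmpty Lyndon-f refl)
  factorisation-unique (f ∷ fs) (g ∷ gs) (Lyndon-f ∷ Lyndon-fs) f∷fs↘ (Lyndon-g ∷ Lyndon-gs) g∷gs↘ w≋ =
    f≋g ∷ factorisation-unique fs gs Lyndon-fs (Linked.tail f∷fs↘) Lyndon-gs (Linked.tail g∷gs↘) rest≋
    where
    |f|≡|g| : length f ≡ length g
    |f|≡|g| = ℕ.≤-antisym (head-length-≤ {gs = fs} Lyndon-g g∷gs↘ Lyndon-f (≋.sym w≋))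
                          (head-length-≤ {gs = gs} Lyndon-f f∷fs↘ Lyndon-g w≋)
    f≋g = proj₁ (≋-++-sameLength f g |f|≡|g| w≋)
    rest≋ = proj₂ (≋-++-sameLength f g |f|≡|g| w≋)


-- Set partitions and their atomic factorisation

-- Matrices are handled through the relation they induce on all of ℕ,
-- which is false outside [0, n); this makes shifting and restricting
-- blocks plain arithmetic on indices.
relℕ : ∀ {n} → Matrix n → ℕ → ℕ → Bool
relℕ {n} M i j with i <? n | j <? n
... | yes i<n | yes j<n = rel M (fromℕ< i<n) (fromℕ< j<n)
... | _       | _       = false

module _ {n} (M : Matrix n) where

  relℕ-fromℕ< : ∀ {i j} (i<n : i < n) (j<n : j < n) → relℕ M i j ≡ rel M (fromℕ< i<n) (fromℕ< j<n)
  relℕ-fromℕ< {i} {j} i<n j<n with i <? n | j <? n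
  ... | yes _  | yes _  = refl
  ... | no i≮n | _      = ⊥-elim (i≮n i<n)
  ... | yes _  | no j≮n = ⊥-elim (j≮n j<n)

  relℕ-≥ˡ : ∀ {i} j → n ≤ i → relℕ M i j ≡ false
  relℕ-≥ˡ {i} j n≤i with i <? n
  ... | yes i<n = ⊥-elim (ℕ.<⇒≱ i<n n≤i)
  ... | no _    = refl

  relℕ-≥ʳ : ∀ i {j} → n ≤ j → relℕ M i j ≡ false
  relℕ-≥ʳ i {j} n≤j with i <? n | j <? n
  ... | _     | yes j<n = ⊥-elim (ℕ.<⇒≱ j<n n≤j)
  ... | yes _ | no _    = refl
  ... | no _  | no _    = refl

  relℕ-true⇒< : ∀ {i j} → relℕ M i j ≡ true → i < n × j < n
  relℕ-true⇒< {i} {j} eq with i <? n | j <? n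
  relℕ-true⇒< _    | yes i<n | yes j<n = i<n , j<n
  relℕ-true⇒< ()   | yes _   | no _
  relℕ-true⇒< ()   | no _    | _

  relℕ-toℕ : ∀ (x y : Fin n) → relℕ M (toℕ x) (toℕ y) ≡ rel M x y
  relℕ-toℕ x y = trans (relℕ-fromℕ< (Fin.toℕ<n x) (Fin.toℕ<n y))
                       (cong₂ (rel M) (Fin.fromℕ<-toℕ x _) (Fin.fromℕ<-toℕ y _))

tabulateRel : (n : ℕ) → (ℕ → ℕ → Bool) → Matrix n
tabulateRel n R = Vec.tabulate λ x → Vec.tabulate λ y → R (toℕ x) (toℕ y)

rel-tabulateRel : ∀ n R (x y : Fin n) → rel (tabulateRel n R) x y ≡ R (toℕ x) (toℕ y)
rel-tabulateRel n R x y = trans (cong (λ row → Vec.lookup row y) (lookup∘tabulate _ x)) (lookup∘tabulate _ y)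

relℕ-tabulateRel : ∀ n R {i j} → i < n → j < n → relℕ (tabulateRel n R) i j ≡ R i j
relℕ-tabulateRel n R i<n j<n =
  trans (relℕ-fromℕ< (tabulateRel n R) i<n j<n)
        (trans (rel-tabulateRel n R _ _) (cong₂ R (Fin.toℕ-fromℕ< i<n) (Fin.toℕ-fromℕ< j<n)))

tabulateRel-relℕ : ∀ {n} (M : Matrix n) → tabulateRel n (relℕ M) ≡ M
tabulateRel-relℕ M =
  trans (tabulate-cong λ x → tabulate-cong λ y → relℕ-toℕ M x y)
        (trans (tabulate-cong λ x → tabulate∘lookup (Vec.lookup M x)) (tabulate∘lookup M))

Matrix-ext : ∀ {n} {M M′ : Matrix n} → (∀ {i j} → i < n → j < n → relℕ M i j ≡ relℕ M′ i j) →
             M ≡ M′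
Matrix-ext {n} {M} {M′} eq = begin
  M                          ≡⟨ tabulateRel-relℕ M ⟨
  tabulateRel n (relℕ M)     ≡⟨ tabulate-cong (λ x → tabulate-cong λ y → eq (Fin.toℕ<n x) (Fin.toℕ<n y)) ⟩
  tabulateRel n (relℕ M′)    ≡⟨ tabulateRel-relℕ M′ ⟩
  M′                         ∎
  where open ≡-Reasoning

relₛ : SP → ℕ → ℕ → Bool
relₛ (_ , M) = relℕ M

SP-ext : ∀ {s s′ : SP} → proj₁ s ≡ proj₁ s′ → (∀ i j → relₛ s i j ≡ relₛ s′ i j) → s ≡ s′
SP-ext {n , M} {.n , M′} refl eq = cong (n ,_) (Matrix-ext λ {i} {j} _ _ → eq i j)

module _ {n k} (A : Matrix n) (B : Matrix k) where

  blockEntry : Fin n ⊎ Fin k → Fin n ⊎ Fin k → Bool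
  blockEntry (inj₁ x) (inj₁ y) = rel A x y
  blockEntry (inj₂ x) (inj₂ y) = rel B x y
  blockEntry _        _        = false

  private
    -- The right-hand side is the local function entry of _∣ₚ_, which cannot be named here.
    rel-∣ₚ-unfolded : ∀ x y → rel (A ∣ₚ B) x y ≡ _
    rel-∣ₚ-unfolded x y = trans (cong (λ row → Vec.lookup row y) (lookup∘tabulate _ x)) (lookup∘tabulate _ y)

  rel-∣ₚ : ∀ x y → rel (A ∣ₚ B) x y ≡ blockEntry (splitAt n x) (splitAt n y)
  rel-∣ₚ x y with splitAt n x | splitAt n y | rel-∣ₚ-unfolded x y
  ... | inj₁ _ | inj₁ _ | eq = eq
  ... | inj₁ _ | inj₂ _ | eq = eq
  ... | inj₂ _ | inj₁ _ | eq = eq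
  ... | inj₂ _ | inj₂ _ | eq = eq

  private
    AB = A ∣ₚ B

    relℕ-∣ₚ-toℕ : ∀ x y {i j} → toℕ x ≡ i → toℕ y ≡ j →
                  relℕ AB i j ≡ blockEntry (splitAt n x) (splitAt n y)
    relℕ-∣ₚ-toℕ x y refl refl = trans (relℕ-toℕ AB x y) (rel-∣ₚ x y)

    toℕ-fromℕ<-↑ˡ : ∀ {i} (i<n : i < n) → toℕ (fromℕ< i<n ↑ˡ k) ≡ i
    toℕ-fromℕ<-↑ˡ i<n = trans (Fin.toℕ-↑ˡ _ k) (Fin.toℕ-fromℕ< i<n)

    toℕ-↑ʳ-fromℕ< : ∀ {i} (i<k : i < k) → toℕ (n ↑ʳ fromℕ< i<k) ≡ n + i
    toℕ-↑ʳ-fromℕ< i<k = trans (Fin.toℕ-↑ʳ n _) (cong (n +_) (Fin.toℕ-fromℕ< i<k))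

    n+k≤ : ∀ {j} → n ≤ j → k ≤ j ∸ n → n + k ≤ j
    n+k≤ n≤j k≤j∸n = subst (n + k ≤_) (ℕ.m+[n∸m]≡n n≤j) (ℕ.+-monoʳ-≤ n k≤j∸n)

  relℕ-∣ₚ-<< : ∀ {i j} → i < n → j < n → relℕ AB i j ≡ relℕ A i j
  relℕ-∣ₚ-<< i<n j<n =
    trans (relℕ-∣ₚ-toℕ _ _ (toℕ-fromℕ<-↑ˡ i<n) (toℕ-fromℕ<-↑ˡ j<n))
          (trans (cong₂ blockEntry (Fin.splitAt-↑ˡ n _ k) (Fin.splitAt-↑ˡ n _ k))
                 (sym (relℕ-fromℕ< A i<n j<n)))

  relℕ-∣ₚ-++ : ∀ i j → relℕ AB (n + i) (n + j) ≡ relℕ B i j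
  relℕ-∣ₚ-++ i j with ℕ.<-≤-connex i k | ℕ.<-≤-connex j k
  ... | inj₁ i<k | inj₁ j<k =
    trans (relℕ-∣ₚ-toℕ _ _ (toℕ-↑ʳ-fromℕ< i<k) (toℕ-↑ʳ-fromℕ< j<k))
          (trans (cong₂ blockEntry (Fin.splitAt-↑ʳ n k _) (Fin.splitAt-↑ʳ n k _))
                 (sym (relℕ-fromℕ< B i<k j<k)))
  ... | inj₂ k≤i | _        = trans (relℕ-≥ˡ AB _ (ℕ.+-monoʳ-≤ n k≤i)) (sym (relℕ-≥ˡ B j k≤i))
  ... | inj₁ _   | inj₂ k≤j = trans (relℕ-≥ʳ AB _ (ℕ.+-monoʳ-≤ n k≤j)) (sym (relℕ-≥ʳ B i k≤j))

  relℕ-∣ₚ-≥≥ : ∀ {i j} → n ≤ i → n ≤ j → relℕ AB i j ≡ relℕ B (i ∸ n) (j ∸ n)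
  relℕ-∣ₚ-≥≥ n≤i n≤j =
    trans (cong₂ (relℕ AB) (sym (ℕ.m+[n∸m]≡n n≤i)) (sym (ℕ.m+[n∸m]≡n n≤j))) (relℕ-∣ₚ-++ _ _)

  relℕ-∣ₚ-<≥ : ∀ {i j} → i < n → n ≤ j → relℕ AB i j ≡ false
  relℕ-∣ₚ-<≥ {i} {j} i<n n≤j with ℕ.<-≤-connex (j ∸ n) k
  ... | inj₂ k≤j∸n = relℕ-≥ʳ AB i (n+k≤ n≤j k≤j∸n)
  ... | inj₁ j∸n<k =
    trans (relℕ-∣ₚ-toℕ _ _ (toℕ-fromℕ<-↑ˡ i<n)
                             (trans (toℕ-↑ʳ-fromℕ< j∸n<k) (ℕ.m+[n∸m]≡n n≤j)))
          (cong₂ blockEntry (Fin.splitAt-↑ˡ n _ k) (Fin.splitAt-↑ʳ n k _))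

  relℕ-∣ₚ-≥< : ∀ {i j} → n ≤ i → j < n → relℕ AB i j ≡ false
  relℕ-∣ₚ-≥< {i} {j} n≤i j<n with ℕ.<-≤-connex (i ∸ n) k
  ... | inj₂ k≤i∸n = relℕ-≥ˡ AB j (n+k≤ n≤i k≤i∸n)
  ... | inj₁ i∸n<k =
    trans (relℕ-∣ₚ-toℕ _ _ (trans (toℕ-↑ʳ-fromℕ< i∸n<k) (ℕ.m+[n∸m]≡n n≤i))
                             (toℕ-fromℕ<-↑ˡ j<n))
          (cong₂ blockEntry (Fin.splitAt-↑ʳ n k _) (Fin.splitAt-↑ˡ n _ k))

false≢true : false ≢ true
false≢true ()

record IsSetPartitionℕ {n} (M : Matrix n) : Set where
  field
    reflexive  : ∀ {i} → i < n → relℕ M i i ≡ true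
    symmetric  : ∀ {i j} → relℕ M i j ≡ true → relℕ M j i ≡ true
    transitive : ∀ {i j l} → relℕ M i j ≡ true → relℕ M j l ≡ true → relℕ M i l ≡ true

  false-sym : ∀ {i j} → relℕ M j i ≡ false → relℕ M i j ≡ false
  false-sym {i} {j} ji≡false with relℕ M i j in ij≡
  ... | false = refl
  ... | true  = trans (sym (symmetric ij≡)) ji≡false

module _ {n} (M : Matrix n) where

  isSetPartition⇒ℕ : IsSetPartition M → IsSetPartitionℕ M
  isSetPartition⇒ℕ (refl′ , sym′ , trans′) = record
    { reflexive  = λ i<n → trans (relℕ-fromℕ< M i<n i<n) (refl′ _)
    ; symmetric  = λ ij → let i<n , j<n = relℕ-true⇒< M ij in
        trans (relℕ-fromℕ< M j<n i<n) (sym′ _ _ (trans (sym (relℕ-fromℕ< M i<n j<n)) ij))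
    ; transitive = λ ij jl → let i<n , j<n = relℕ-true⇒< M ij ; _ , l<n = relℕ-true⇒< M jl in
        trans (relℕ-fromℕ< M i<n l<n)
              (trans′ _ _ _ (trans (sym (relℕ-fromℕ< M i<n j<n)) ij) (trans (sym (relℕ-fromℕ< M j<n l<n)) jl))
    }

  ℕ⇒isSetPartition : IsSetPartitionℕ M → IsSetPartition M
  ℕ⇒isSetPartition M-sp =
    (λ x → trans (sym (relℕ-toℕ M x x)) (reflexive (Fin.toℕ<n x))) ,
    (λ x y xy → trans (sym (relℕ-toℕ M y x)) (symmetric (trans (relℕ-toℕ M x y) xy))) ,
    (λ x y z xy yz → trans (sym (relℕ-toℕ M x z))
                           (transitive (trans (relℕ-toℕ M x y) xy) (trans (relℕ-toℕ M y z) yz)))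
    where open IsSetPartitionℕ M-sp

tabulateRel-isSetPartitionℕ : ∀ m (R : ℕ → ℕ → Bool) →
  (∀ {i} → i < m → R i i ≡ true) →
  (∀ {i j} → i < m → j < m → R i j ≡ true → R j i ≡ true) →
  (∀ {i j l} → i < m → j < m → l < m → R i j ≡ true → R j l ≡ true → R i l ≡ true) →
  IsSetPartitionℕ (tabulateRel m R)
tabulateRel-isSetPartitionℕ m R refl′ sym′ trans′ = record
  { reflexive  = λ i<m → trans (relℕ-tabulateRel m R i<m i<m) (refl′ i<m)
  ; symmetric  = λ ij → let i<m , j<m = relℕ-true⇒< M ij in
      trans (relℕ-tabulateRel m R j<m i<m) (sym′ i<m j<m (trans (sym (relℕ-tabulateRel m R i<m j<m)) ij))
  ; transitive = λ ij jl → let i<m , j<m = relℕ-true⇒< M ij ; _ , l<m = relℕ-true⇒< M jl in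
      trans (relℕ-tabulateRel m R i<m l<m)
            (trans′ i<m j<m l<m (trans (sym (relℕ-tabulateRel m R i<m j<m)) ij)
                                (trans (sym (relℕ-tabulateRel m R j<m l<m)) jl))
  }
  where M = tabulateRel m R

[]-isSetPartitionℕ : IsSetPartitionℕ {0} Vec.[]
[]-isSetPartitionℕ = record
  { reflexive  = λ ()
  ; symmetric  = λ {i} {j} ij → ⊥-elim (ℕ.n≮0 (proj₁ (relℕ-true⇒< Vec.[] {i} {j} ij)))
  ; transitive = λ {i} {j} ij _ → ⊥-elim (ℕ.n≮0 (proj₁ (relℕ-true⇒< Vec.[] {i} {j} ij)))
  }

module _ {n k} (A : Matrix n) (B : Matrix k) where

  private
    AB = A ∣ₚ B

  relℕ-∣ₚ-true : ∀ {i j} → relℕ AB i j ≡ true →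
                 (i < n × j < n × relℕ A i j ≡ true) ⊎ (n ≤ i × n ≤ j × relℕ B (i ∸ n) (j ∸ n) ≡ true)
  relℕ-∣ₚ-true {i} {j} ij with ℕ.<-≤-connex i n | ℕ.<-≤-connex j n
  ... | inj₁ i<n | inj₁ j<n = inj₁ (i<n , j<n , trans (sym (relℕ-∣ₚ-<< A B i<n j<n)) ij)
  ... | inj₁ i<n | inj₂ n≤j = ⊥-elim (false≢true (trans (sym (relℕ-∣ₚ-<≥ A B i<n n≤j)) ij))
  ... | inj₂ n≤i | inj₁ j<n = ⊥-elim (false≢true (trans (sym (relℕ-∣ₚ-≥< A B n≤i j<n)) ij))
  ... | inj₂ n≤i | inj₂ n≤j = inj₂ (n≤i , n≤j , trans (sym (relℕ-∣ₚ-≥≥ A B n≤i n≤j)) ij)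

  ∣ₚ-isSetPartitionℕ : IsSetPartitionℕ A → IsSetPartitionℕ B → IsSetPartitionℕ AB
  ∣ₚ-isSetPartitionℕ A-sp B-sp =
    record { reflexive = reflexive′ ; symmetric = symmetric′ ; transitive = transitive′ }
    where
    module A = IsSetPartitionℕ A-sp
    module B = IsSetPartitionℕ B-sp
    reflexive′ : ∀ {i} → i < n + k → relℕ AB i i ≡ true
    reflexive′ {i} i<n+k with ℕ.<-≤-connex i n
    ... | inj₁ i<n = trans (relℕ-∣ₚ-<< A B i<n i<n) (A.reflexive i<n)
    ... | inj₂ n≤i = trans (relℕ-∣ₚ-≥≥ A B n≤i n≤i)
                           (B.reflexive (subst (i ∸ n <_) (ℕ.m+n∸m≡n n k) (ℕ.∸-monoˡ-< i<n+k n≤i)))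
    symmetric′ : ∀ {i j} → relℕ AB i j ≡ true → relℕ AB j i ≡ true
    symmetric′ ij with relℕ-∣ₚ-true ij
    ... | inj₁ (i<n , j<n , ij′) = trans (relℕ-∣ₚ-<< A B j<n i<n) (A.symmetric ij′)
    ... | inj₂ (n≤i , n≤j , ij′) = trans (relℕ-∣ₚ-≥≥ A B n≤j n≤i) (B.symmetric ij′)
    transitive′ : ∀ {i j l} → relℕ AB i j ≡ true → relℕ AB j l ≡ true → relℕ AB i l ≡ true
    transitive′ ij jl with relℕ-∣ₚ-true ij | relℕ-∣ₚ-true jl
    ... | inj₁ (i<n , _ , ij′) | inj₁ (_ , l<n , jl′) =
      trans (relℕ-∣ₚ-<< A B i<n l<n) (A.transitive ij′ jl′)
    ... | inj₂ (n≤i , _ , ij′) | inj₂ (_ , n≤l , jl′) =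
      trans (relℕ-∣ₚ-≥≥ A B n≤i n≤l) (B.transitive ij′ jl′)
    ... | inj₁ (_ , j<n , _)   | inj₂ (n≤j , _ , _)   = ⊥-elim (ℕ.<⇒≱ j<n n≤j)
    ... | inj₂ (_ , n≤j , _)   | inj₁ (j<n , _ , _)   = ⊥-elim (ℕ.<⇒≱ j<n n≤j)

SplitsAt : ∀ {n} → Matrix n → ℕ → Set
SplitsAt M k = ∀ {i j} → i < k → k ≤ j → relℕ M i j ≡ false

prefixBlock : ∀ {n} k → Matrix n → Matrix k
prefixBlock k M = tabulateRel k (relℕ M)

suffixBlock : ∀ {n} k → Matrix n → Matrix (n ∸ k)
suffixBlock {n} k M = tabulateRel (n ∸ k) (λ i j → relℕ M (k + i) (k + j))

module _ {n} (M : Matrix n) where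

  private
    n≤k+ : ∀ {k i} → k ≤ n → n ∸ k ≤ i → n ≤ k + i
    n≤k+ {k} k≤n n-k≤i = subst (_≤ k + _) (ℕ.m+[n∸m]≡n k≤n) (ℕ.+-monoʳ-≤ k n-k≤i)

  relℕ-suffixBlock : ∀ {k} → k ≤ n → ∀ i j → relℕ (suffixBlock k M) i j ≡ relℕ M (k + i) (k + j)
  relℕ-suffixBlock {k} k≤n i j with ℕ.<-≤-connex i (n ∸ k) | ℕ.<-≤-connex j (n ∸ k)
  ... | inj₁ i<n-k | inj₁ j<n-k = relℕ-tabulateRel (n ∸ k) _ i<n-k j<n-k
  ... | inj₂ n-k≤i | _          =
    trans (relℕ-≥ˡ (suffixBlock k M) j n-k≤i) (sym (relℕ-≥ˡ M _ (n≤k+ k≤n n-k≤i)))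
  ... | inj₁ _     | inj₂ n-k≤j =
    trans (relℕ-≥ʳ (suffixBlock k M) i n-k≤j) (sym (relℕ-≥ʳ M _ (n≤k+ k≤n n-k≤j)))

  module _ (M-sp : IsSetPartitionℕ M) where
    open IsSetPartitionℕ M-sp

    prefixBlock-isSetPartitionℕ : ∀ {k} → k ≤ n → IsSetPartitionℕ (prefixBlock k M)
    prefixBlock-isSetPartitionℕ {k} k≤n = tabulateRel-isSetPartitionℕ k (relℕ M)
      (λ i<k → reflexive (ℕ.<-≤-trans i<k k≤n)) (λ _ _ → symmetric) (λ _ _ _ → transitive)

    suffixBlock-isSetPartitionℕ : ∀ {k} → k ≤ n → IsSetPartitionℕ (suffixBlock k M)
    suffixBlock-isSetPartitionℕ {k} k≤n = tabulateRel-isSetPartitionℕ (n ∸ k) (λ i j → relℕ M (k + i) (k + j))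
      (λ i<n-k → reflexive (subst (k + _ <_) (ℕ.m+[n∸m]≡n k≤n) (ℕ.+-monoʳ-< k i<n-k)))
      (λ _ _ → symmetric) (λ _ _ _ → transitive)

    splitsAt⇒∣ₛ : ∀ {k} → k ≤ n → SplitsAt M k →
                  (k , prefixBlock k M) ∣ₛ (n ∸ k , suffixBlock k M) ≡ (n , M)
    splitsAt⇒∣ₛ {k} k≤n splits = SP-ext (ℕ.m+[n∸m]≡n k≤n) same
      where
      P = prefixBlock k M
      S = suffixBlock k M
      same : ∀ i j → relℕ (P ∣ₚ S) i j ≡ relℕ M i j
      same i j with ℕ.<-≤-connex i k | ℕ.<-≤-connex j k
      ... | inj₁ i<k | inj₁ j<k = trans (relℕ-∣ₚ-<< P S i<k j<k) (relℕ-tabulateRel k (relℕ M) i<k j<k)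
      ... | inj₁ i<k | inj₂ k≤j = trans (relℕ-∣ₚ-<≥ P S i<k k≤j) (sym (splits i<k k≤j))
      ... | inj₂ k≤i | inj₁ j<k = trans (relℕ-∣ₚ-≥< P S k≤i j<k) (sym (false-sym (splits j<k k≤i)))
      ... | inj₂ k≤i | inj₂ k≤j =
        trans (relℕ-∣ₚ-≥≥ P S k≤i k≤j)
              (trans (relℕ-suffixBlock k≤n _ _) (cong₂ (relℕ M) (ℕ.m+[n∸m]≡n k≤i) (ℕ.m+[n∸m]≡n k≤j)))

∣ₚ-splitsAt : ∀ {n k} (A : Matrix n) (B : Matrix k) → SplitsAt (A ∣ₚ B) n
∣ₚ-splitsAt A B = relℕ-∣ₚ-<≥ A B

splitsAt-∣ₚ⁻ : ∀ {n k} (A : Matrix n) (B : Matrix k) {j} → j ≤ n → SplitsAt (A ∣ₚ B) j → SplitsAt A j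
splitsAt-∣ₚ⁻ {n} A B j≤n splits {i} {i′} i<j j≤i′ with ℕ.<-≤-connex i′ n
... | inj₁ i′<n = trans (sym (relℕ-∣ₚ-<< A B (ℕ.<-≤-trans i<j j≤n) i′<n)) (splits i<j j≤i′)
... | inj₂ n≤i′ = relℕ-≥ʳ A i n≤i′

∣ₛ-cancel : ∀ {s s′ t t′ : SP} → proj₁ s ≡ proj₁ s′ → s ∣ₛ t ≡ s′ ∣ₛ t′ → s ≡ s′ × t ≡ t′
∣ₛ-cancel {k , A} {.k , A′} {l , B} {l′ , B′} refl eq = SP-ext refl same-prefix , SP-ext l≡l′ same-suffix
  where
  relₛ-eq : ∀ i j → relℕ (A ∣ₚ B) i j ≡ relℕ (A′ ∣ₚ B′) i j
  relₛ-eq i j = cong (λ s → relₛ s i j) eq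
  l≡l′ : l ≡ l′
  l≡l′ = ℕ.+-cancelˡ-≡ k l l′ (cong proj₁ eq)
  same-prefix : ∀ i j → relℕ A i j ≡ relℕ A′ i j
  same-prefix i j with ℕ.<-≤-connex i k | ℕ.<-≤-connex j k
  ... | inj₁ i<k | inj₁ j<k =
    trans (sym (relℕ-∣ₚ-<< A B i<k j<k)) (trans (relₛ-eq i j) (relℕ-∣ₚ-<< A′ B′ i<k j<k))
  ... | inj₂ k≤i | _        = trans (relℕ-≥ˡ A j k≤i) (sym (relℕ-≥ˡ A′ j k≤i))
  ... | inj₁ _   | inj₂ k≤j = trans (relℕ-≥ʳ A i k≤j) (sym (relℕ-≥ʳ A′ i k≤j))
  same-suffix : ∀ i j → relℕ B i j ≡ relℕ B′ i j
  same-suffix i j =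
    trans (sym (relℕ-∣ₚ-++ A B i j)) (trans (relₛ-eq (k + i) (k + j)) (relℕ-∣ₚ-++ A′ B′ i j))

size : Atom → ℕ
size a = proj₁ (underlying a)

matrix : (a : Atom) → Matrix (size a)
matrix a = proj₂ (underlying a)

atom-size≥1 : ∀ a → 1 ≤ size a
atom-size≥1 (_ , _ , _ , 1≤n , _) = 1≤n

atom-isSetPartitionℕ : ∀ a → IsSetPartitionℕ (matrix a)
atom-isSetPartitionℕ (_ , M , M-sp , _) = isSetPartition⇒ℕ M M-sp

atom-unsplittable : ∀ a {j} → 1 ≤ j → j < size a → ¬ SplitsAt (matrix a) j
atom-unsplittable (n , M , M-sp , _ , indecomposable) {j} 1≤j j<n splits =
  indecomposable (j , n ∸ j , prefixBlock j M , suffixBlock j M , 1≤j , ℕ.m<n⇒0<n∸m j<n ,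
                  ℕ⇒isSetPartition _ (prefixBlock-isSetPartitionℕ M M-spℕ j≤n) ,
                  ℕ⇒isSetPartition _ (suffixBlock-isSetPartitionℕ M M-spℕ j≤n) ,
                  splitsAt⇒∣ₛ M M-spℕ j≤n splits)
  where
  M-spℕ = isSetPartition⇒ℕ M M-sp
  j≤n = ℕ.<⇒≤ j<n

SplitsAtₛ : SP → ℕ → Set
SplitsAtₛ (_ , M) = SplitsAt M

atom-∣ₛ-sameSize : ∀ a a′ {X X′} → underlying a ∣ₛ X ≡ underlying a′ ∣ₛ X′ → size a ≡ size a′
atom-∣ₛ-sameSize a a′ {_ , X} {_ , X′} eq with ℕ.<-cmp (size a) (size a′)
... | tri≈ _ k≡k′ _ = k≡k′
... | tri< k<k′ _ _ = ⊥-elim (atom-unsplittable a′ (atom-size≥1 a) k<k′ (splitsAt-∣ₚ⁻ (matrix a′) X′ (ℕ.<⇒≤ k<k′)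
    (subst (λ s → SplitsAtₛ s (size a)) eq (∣ₚ-splitsAt (matrix a) X))))
... | tri> _ _ k′<k = ⊥-elim (atom-unsplittable a (atom-size≥1 a′) k′<k (splitsAt-∣ₚ⁻ (matrix a) X (ℕ.<⇒≤ k′<k)
    (subst (λ s → SplitsAtₛ s (size a′)) (sym eq) (∣ₚ-splitsAt (matrix a′) X′))))

concatAtoms-isSetPartitionℕ : ∀ w → IsSetPartitionℕ (proj₂ (concatAtoms w))
concatAtoms-isSetPartitionℕ []      = []-isSetPartitionℕ
concatAtoms-isSetPartitionℕ (a ∷ w) =
  ∣ₚ-isSetPartitionℕ (matrix a) _ (atom-isSetPartitionℕ a) (concatAtoms-isSetPartitionℕ w)

size-concatAtoms-++ : ∀ u v → proj₁ (concatAtoms (u ++ v)) ≡ proj₁ (concatAtoms u) + proj₁ (concatAtoms v)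
size-concatAtoms-++ []      v = refl
size-concatAtoms-++ (a ∷ u) v = trans (cong (size a +_) (size-concatAtoms-++ u v)) (sym (ℕ.+-assoc (size a) _ _))

size-concatAtoms≥1 : ∀ w → w ≢ [] → 1 ≤ proj₁ (concatAtoms w)
size-concatAtoms≥1 []      w≢[] = ⊥-elim (w≢[] refl)
size-concatAtoms≥1 (a ∷ w) _    = ℕ.≤-trans (atom-size≥1 a) (ℕ.m≤m+n _ _)

concatAtoms-resp : ∀ {w w′} → Pointwise _≈ₐ_ w w′ → concatAtoms w ≡ concatAtoms w′
concatAtoms-resp []          = refl
concatAtoms-resp (a≈a′ ∷ ≈) = cong₂ _∣ₛ_ a≈a′ (concatAtoms-resp ≈)

concatAtoms-injective : ∀ w w′ → concatAtoms w ≡ concatAtoms w′ → Pointwise _≈ₐ_ w w′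
concatAtoms-injective []       []        _  = []
concatAtoms-injective []       (a′ ∷ w′) eq =
  ⊥-elim (ℕ.<⇒≢ (size-concatAtoms≥1 (a′ ∷ w′) λ ()) (cong proj₁ eq))
concatAtoms-injective (a ∷ w)  []        eq =
  ⊥-elim (ℕ.<⇒≢ (size-concatAtoms≥1 (a ∷ w) λ ()) (sym (cong proj₁ eq)))
concatAtoms-injective (a ∷ w)  (a′ ∷ w′) eq =
  let a≈a′ , w≡w′ = ∣ₛ-cancel (atom-∣ₛ-sameSize a a′ eq) eq
  in a≈a′ ∷ concatAtoms-injective w w′ w≡w′

splitsAt? : ∀ {n} (M : Matrix n) k → Dec (SplitsAt M k)
splitsAt? {n} M k = map′ splits-within (λ splits i<k _ k≤j → splits i<k k≤j) splits-within?
  where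
  splits-within? : Dec (∀ {i} → i < k → ∀ {j} → j < n → k ≤ j → relℕ M i j ≡ false)
  splits-within? = ℕ.allUpTo? (λ i → ℕ.allUpTo? (λ j → (k ≤? j) →-dec (relℕ M i j ≟ᵇ false)) n) k
  splits-within : (∀ {i} → i < k → ∀ {j} → j < n → k ≤ j → relℕ M i j ≡ false) → SplitsAt M k
  splits-within h {i} {j} i<k k≤j with ℕ.<-≤-connex j n
  ... | inj₁ j<n = h i<k j<n k≤j
  ... | inj₂ n≤j = relℕ-≥ʳ M i n≤j

minimalSplit⇒atomic : ∀ {n} (M : Matrix n) {j} → SplitsAt M j →
                      (∀ {k} → 1 ≤ k → k < j → ¬ SplitsAt M k) → 1 ≤ j → IsAtomic (prefixBlock j M)
minimalSplit⇒atomic M {j} splits-j minimal 1≤j =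
  1≤j , λ (k , l , B , C , 1≤k , 1≤l , _ , _ , eq) →
    let k<j = subst (k <_) (cong proj₁ eq) (ℕ.m<m+n k 1≤l)
    in minimal 1≤k k<j (splits-k k<j (subst (λ s → SplitsAtₛ s k) eq (∣ₚ-splitsAt B C)))
  where
  splits-k : ∀ {k} → k < j → SplitsAt (prefixBlock j M) k → SplitsAt M k
  splits-k k<j prefix-splits {i} {i′} i<k k≤i′ with ℕ.<-≤-connex i′ j
  ... | inj₁ i′<j =
    trans (sym (relℕ-tabulateRel j (relℕ M) (ℕ.<-trans i<k k<j) i′<j)) (prefix-splits i<k k≤i′)
  ... | inj₂ j≤i′ = splits-j (ℕ.<-trans i<k k<j) j≤i′

AtomicFactorisation : ∀ n → Matrix n → Set
AtomicFactorisation n M = Σ[ w ∈ List Atom ] concatAtoms w ≡ (n , M)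

-- Split off the prefix up to the least positive split point: it is an atom.
atomicFactorisationℕ : ∀ n (M : Matrix n) → IsSetPartitionℕ M → AtomicFactorisation n M
atomicFactorisationℕ = <-rec _ factorise
  where
  factorise : ∀ n → (∀ {m} → m < n → ∀ M → IsSetPartitionℕ M → AtomicFactorisation m M) →
              ∀ M → IsSetPartitionℕ M → AtomicFactorisation n M
  factorise zero    _         Vec.[] _    = [] , refl
  factorise (suc n) factorise< M           M-sp
    with least (λ j → splitsAt? M (suc j)) n (λ {i} _ → relℕ-≥ʳ M i)
  ... | j , j≤n , splits-j , ¬splits<j =
    atom ∷ w , trans (cong (underlying atom ∣ₛ_) eq) (splitsAt⇒∣ₛ M M-sp j<n+1 splits-j)
    where
    j<n+1 = s≤s j≤n
    atom : Atom
    atom = suc j , prefixBlock (suc j) M , ℕ⇒isSetPartition _ (prefixBlock-isSetPartitionℕ M M-sp j<n+1) ,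
           minimalSplit⇒atomic M splits-j (λ { (s≤s _) (s≤s k<j) → ¬splits<j k<j }) (s≤s z≤n)
    rest = factorise< (s≤s (ℕ.m∸n≤m n j)) (suffixBlock (suc j) M) (suffixBlock-isSetPartitionℕ M M-sp j<n+1)
    w = proj₁ rest
    eq = proj₂ rest

atomicFactorisation : ∀ {n} (M : Matrix n) → IsSetPartition M → AtomicFactorisation n M
atomicFactorisation M M-sp = atomicFactorisationℕ _ M (isSetPartition⇒ℕ M M-sp)

-- Coefficients of products of geometric series

range : ℕ → List ℕ
range zero    = 0 ∷ []
range (suc n) = range n ++ suc n ∷ []

∈-range⁺ : ∀ {n i} → i ≤ n → i ∈ range n
∈-range⁺ {zero}  z≤n = here refl
∈-range⁺ {suc n} i≤1+n with ℕ.m≤n⇒m<n∨m≡n i≤1+n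
... | inj₁ i<1+n = ∈-++⁺ˡ (∈-range⁺ (ℕ.≤-pred i<1+n))
... | inj₂ refl  = ∈-++⁺ʳ (range n) (here refl)

∈-range⁻ : ∀ {n i} → i ∈ range n → i ≤ n
∈-range⁻ {zero}  (here refl) = z≤n
∈-range⁻ {suc n} i∈ with ∈-++⁻ (range n) i∈
... | inj₁ i∈range-n    = ℕ.m≤n⇒m≤1+n (∈-range⁻ i∈range-n)
... | inj₂ (here refl) = ℕ.≤-refl

range-unique : ∀ n → Unique (range n)
range-unique zero    = [] ∷ []
range-unique (suc n) = Unique.++⁺ (range-unique n) ([] ∷ [])
  λ { (i∈ , here refl) → ℕ.<-irrefl refl (s≤s (∈-range⁻ i∈)) }

sumTo-cong : ∀ n {f g : ℕ → ℕ} → (∀ i → f i ≡ g i) → sumTo n f ≡ sumTo n g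
sumTo-cong zero    f≗g = f≗g 0
sumTo-cong (suc n) f≗g = cong₂ _+_ (sumTo-cong n f≗g) (f≗g (suc n))

length-concatMap-range : ∀ {B : Set} n (H : ℕ → List B) → length (concatMap H (range n)) ≡ sumTo n (length ∘ H)
length-concatMap-range zero    H = trans (length-++ (H 0)) (ℕ.+-identityʳ _)
length-concatMap-range (suc n) H = begin
  length (concatMap H (range n ++ suc n ∷ []))
    ≡⟨ cong (length ∘ concat) (map-++ H (range n) (suc n ∷ [])) ⟩
  length (concat (map H (range n) ++ H (suc n) ∷ []))
    ≡⟨ cong length (concat-++ (map H (range n)) (H (suc n) ∷ [])) ⟨
  length (concatMap H (range n) ++ H (suc n) ++ [])
    ≡⟨ length-++ (concatMap H (range n)) ⟩
  length (concatMap H (range n)) + length (H (suc n) ++ [])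
    ≡⟨ cong₂ _+_ (length-concatMap-range n H) (cong length (++-identityʳ (H (suc n)))) ⟩
  sumTo n (length ∘ H) + length (H (suc n)) ∎
  where open ≡-Reasoning

weight : List ℕ → List ℕ → ℕ
weight (s ∷ ss) (m ∷ μ) = m * s + weight ss μ
weight _        _       = 0

weight-++ : ∀ s t μ ν → length μ ≡ length s → weight (s ++ t) (μ ++ ν) ≡ weight s μ + weight t ν
weight-++ []       t []      ν _      = refl
weight-++ (s ∷ ss) t (m ∷ μ) ν |μ|≡|s| =
  trans (cong (m * s +_) (weight-++ ss t μ ν (ℕ.suc-injective |μ|≡|s|))) (sym (ℕ.+-assoc (m * s) _ _))

Family : Set
Family = ℕ → List (List ℕ)

-- F n lists the solutions μ of μ₁ s₁ + ⋯ + μₖ sₖ = n, so that length ∘ F is ∏ᵢ 1/(1 - q^sᵢ).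
record Enumerates (s : List ℕ) (F : Family) : Set where
  field
    sound    : ∀ {n μ} → μ ∈ F n → length μ ≡ length s × weight s μ ≡ n
    complete : ∀ {n μ} → length μ ≡ length s → weight s μ ≡ n → μ ∈ F n
    unique   : ∀ n → Unique (F n)

_⊛_ : Family → Family → Family
(F ⊛ G) n = concatMap (λ i → cartesianProductWith _++_ (F i) (G (n ∸ i))) (range n)

length-⊛ : ∀ F G n → length ((F ⊛ G) n) ≡ ((length ∘ F) *ₚ (length ∘ G)) n
length-⊛ F G n = trans (length-concatMap-range n _)
  (sumTo-cong n λ i → length-cartesianProductWith _++_ (F i) (G (n ∸ i)))

module _ {s t F G} (F-enum : Enumerates s F) (G-enum : Enumerates t G) where

  private
    module F = Enumerates F-enum
    module G = Enumerates G-enum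

  ⊛-sound : ∀ {n μ} → μ ∈ (F ⊛ G) n → length μ ≡ length (s ++ t) × weight (s ++ t) μ ≡ n
  ⊛-sound {n} μ∈ with find (∈-concatMap⁻ _ {xs = range n} μ∈)
  ... | i , i∈range , μ∈FG with ∈-cartesianProductWith⁻ _++_ (F i) (G (n ∸ i)) μ∈FG
  ...   | x , y , x∈F , y∈G , refl =
    let |x| , wx = F.sound x∈F
        |y| , wy = G.sound y∈G
    in trans (length-++ x) (trans (cong₂ _+_ |x| |y|) (sym (length-++ s))) ,
       trans (weight-++ s t x y |x|) (trans (cong₂ _+_ wx wy) (ℕ.m+[n∸m]≡n (∈-range⁻ i∈range)))

  ⊛-complete : ∀ {n μ} → length μ ≡ length (s ++ t) → weight (s ++ t) μ ≡ n → μ ∈ (F ⊛ G) n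
  ⊛-complete {n} {μ} |μ| wμ =
    ∈-concatMap⁺ _ (lose (∈-range⁺ i≤n)
      (subst (_∈ cartesianProductWith _++_ (F i) (G (n ∸ i))) (take++drop≡id (length s) μ)
        (∈-cartesianProductWith⁺ _++_ (F.complete |x| refl) (G.complete |y| wy))))
    where
    x = take (length s) μ
    y = drop (length s) μ
    |μ|≡ : length μ ≡ length s + length t
    |μ|≡ = trans |μ| (length-++ s)
    |x| : length x ≡ length s
    |x| = trans (length-take (length s) μ) (ℕ.m≤n⇒m⊓n≡m (subst (length s ≤_) (sym |μ|≡) (ℕ.m≤m+n _ _)))
    |y| : length y ≡ length t
    |y| = trans (length-drop (length s) μ) (trans (cong (_∸ length s) |μ|≡) (ℕ.m+n∸m≡n (length s) (length t)))
    i = weight s x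
    wx+wy : i + weight t y ≡ n
    wx+wy = trans (sym (weight-++ s t x y |x|)) (trans (cong (weight (s ++ t)) (take++drop≡id (length s) μ)) wμ)
    i≤n : i ≤ n
    i≤n = subst (i ≤_) wx+wy (ℕ.m≤m+n _ _)
    wy : weight t y ≡ n ∸ i
    wy = trans (sym (ℕ.m+n∸m≡n i (weight t y))) (cong (_∸ i) wx+wy)

  ⊛-unique : ∀ n → Unique ((F ⊛ G) n)
  ⊛-unique n = concatMap-unique _ product-unique product-disjoint (range-unique n)
    where
    product-unique : ∀ i → Unique (cartesianProductWith _++_ (F i) (G (n ∸ i)))
    product-unique i =
      ++-product-unique (F i) (G (n ∸ i)) (All.tabulate (proj₁ ∘ F.sound)) (F.unique i) (G.unique (n ∸ i))
    product-disjoint : ∀ {i i′} → i ≢ i′ →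
      Disjoint (cartesianProductWith _++_ (F i) (G (n ∸ i))) (cartesianProductWith _++_ (F i′) (G (n ∸ i′)))
    product-disjoint {i} {i′} i≢i′ (μ∈ , μ∈′) =
      let x , _ , x∈F , _ , μ≡xy = ∈-cartesianProductWith⁻ _++_ (F i) _ μ∈
          x′ , _ , x′∈F , _ , μ≡x′y′ = ∈-cartesianProductWith⁻ _++_ (F i′) _ μ∈′
          |x| , wx = F.sound x∈F
          |x′| , wx′ = F.sound x′∈F
          x≡x′ = proj₁ (++-cancel-sameLength x x′ (trans |x| (sym |x′|)) (trans (sym μ≡xy) μ≡x′y′))
      in i≢i′ (trans (sym wx) (trans (cong (weight s) x≡x′) wx′))

  ⊛-enumerates : Enumerates (s ++ t) (F ⊛ G)
  ⊛-enumerates = record { sound = ⊛-sound ; complete = ⊛-complete ; unique = ⊛-unique }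

*ₚ-cong : ∀ {f f′ g g′ : PS} → (∀ i → f i ≡ f′ i) → (∀ i → g i ≡ g′ i) →
          ∀ n → (f *ₚ g) n ≡ (f′ *ₚ g′) n
*ₚ-cong f≗f′ g≗g′ n = sumTo-cong n λ i → cong₂ _*_ (f≗f′ i) (g≗g′ (n ∸ i))

unitFamily : Family
unitFamily zero    = [] ∷ []
unitFamily (suc _) = []

geometricFamily : ℕ → Family
geometricFamily j n = if (n % suc j) ≡ᵇ 0 then (n / suc j ∷ []) ∷ [] else []

powerFamily : ℕ → ℕ → Family
powerFamily j zero    = unitFamily
powerFamily j (suc c) = geometricFamily j ⊛ powerFamily j c

productFamily : (ℕ → ℕ) → ℕ → Family
productFamily b zero    = unitFamily
productFamily b (suc N) = productFamily b N ⊛ powerFamily N (b (suc N))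

sizes : (ℕ → ℕ) → ℕ → List ℕ
sizes b zero    = []
sizes b (suc N) = sizes b N ++ replicate (b (suc N)) (suc N)

length-unitFamily : ∀ n → length (unitFamily n) ≡ oneₚ n
length-unitFamily zero    = refl
length-unitFamily (suc n) = refl

length-geometricFamily : ∀ j n → length (geometricFamily j n) ≡ geomInv j n
length-geometricFamily j n with (n % suc j) ≡ᵇ 0
... | true  = refl
... | false = refl

length-powerFamily : ∀ j c n → length (powerFamily j c n) ≡ (geomInv j ^ₚ c) n
length-powerFamily j zero    n = length-unitFamily n
length-powerFamily j (suc c) n =
  trans (length-⊛ (geometricFamily j) (powerFamily j c) n)
        (*ₚ-cong (length-geometricFamily j) (length-powerFamily j c) n)

length-productFamily : ∀ b N n → length (productFamily b N n) ≡ prodUpTo b N n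
length-productFamily b zero    n = length-unitFamily n
length-productFamily b (suc N) n =
  trans (length-⊛ (productFamily b N) (powerFamily N (b (suc N))) n)
        (*ₚ-cong (length-productFamily b N) (length-powerFamily N (b (suc N))) n)

unit-enumerates : Enumerates [] unitFamily
unit-enumerates = record { sound = sound′ ; complete = complete′ ; unique = unique′ }
  where
  sound′ : ∀ {n μ} → μ ∈ unitFamily n → length μ ≡ 0 × 0 ≡ n
  sound′ {zero} (here refl) = refl , refl
  complete′ : ∀ {n μ} → length μ ≡ 0 → 0 ≡ n → μ ∈ unitFamily n
  complete′ {μ = []} _ refl = here refl
  unique′ : ∀ n → Unique (unitFamily n)
  unique′ zero    = [] ∷ []
  unique′ (suc n) = []

geometric-enumerates : ∀ j → Enumerates (suc j ∷ []) (geometricFamily j)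
geometric-enumerates j = record { sound = sound′ ; complete = complete′ ; unique = unique′ }
  where
  sound′ : ∀ {n μ} → μ ∈ geometricFamily j n → length μ ≡ 1 × weight (suc j ∷ []) μ ≡ n
  sound′ {n} μ∈ with (n % suc j) ≡ᵇ 0 in divides
  sound′ {n} (here refl) | true = refl , (begin
    n / suc j * suc j + 0         ≡⟨ ℕ.+-identityʳ _ ⟩
    n / suc j * suc j             ≡⟨ cong (_+ n / suc j * suc j) (ℕ.≡ᵇ⇒≡ _ 0 (subst T (sym divides) _)) ⟨
    n % suc j + n / suc j * suc j ≡⟨ m≡m%n+[m/n]*n n (suc j) ⟨
    n                             ∎)
    where open ≡-Reasoning
  complete′ : ∀ {n μ} → length μ ≡ 1 → weight (suc j ∷ []) μ ≡ n → μ ∈ geometricFamily j n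
  complete′ {μ = m ∷ []} _ refl =
    subst (λ n → (m ∷ []) ∈ geometricFamily j n) (sym (ℕ.+-identityʳ (m * suc j))) m∈
    where
    m∈ : (m ∷ []) ∈ geometricFamily j (m * suc j)
    m∈ rewrite m*n%n≡0 m (suc j) {{_}} | m*n/n≡m m (suc j) {{_}} = here refl
  unique′ : ∀ n → Unique (geometricFamily j n)
  unique′ n with (n % suc j) ≡ᵇ 0
  ... | true  = [] ∷ []
  ... | false = []

power-enumerates : ∀ j c → Enumerates (replicate c (suc j)) (powerFamily j c)
power-enumerates j zero    = unit-enumerates
power-enumerates j (suc c) = ⊛-enumerates (geometric-enumerates j) (power-enumerates j c)

product-enumerates : ∀ b N → Enumerates (sizes b N) (productFamily b N)
product-enumerates b zero    = unit-enumerates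
product-enumerates b (suc N) = ⊛-enumerates (product-enumerates b N) (power-enumerates N (b (suc N)))

δ : ∀ {m} → Fin m → Fin m → ℕ
δ x y = if does (x ≟ y) then 1 else 0

δ-refl : ∀ {m} (x : Fin m) → δ x x ≡ 1
δ-refl x with x ≟ x
... | yes _  = refl
... | no x≢x = ⊥-elim (x≢x refl)

δ-sym : ∀ {m} (x y : Fin m) → δ x y ≡ δ y x
δ-sym x y with x ≟ y | y ≟ x
... | yes _   | yes _   = refl
... | no _    | no _    = refl
... | yes x≡y | no y≢x  = ⊥-elim (y≢x (sym x≡y))
... | no x≢y  | yes y≡x = ⊥-elim (x≢y (sym y≡x))

∑-δ : ∀ {m} (q : Fin m) (g : Fin m → ℕ) → ∑[ x < m ] (δ x q * g x) ≡ g q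
∑-δ {suc m} zero    g =
  trans (cong (g zero + 0 +_) (sum-replicate-zero m)) (trans (ℕ.+-identityʳ _) (ℕ.+-identityʳ _))
∑-δ {suc m} (suc q) g = ∑-δ q (g ∘ suc)

sum-tabulate : ∀ {m} (h : Fin m → ℕ) → sum (tabulate h) ≡ ∑[ x < m ] h x
sum-tabulate {zero}  h = refl
sum-tabulate {suc m} h = cong (h zero +_) (sum-tabulate (h ∘ suc))

at : List ℕ → ℕ → ℕ
at []      _       = 0
at (x ∷ _) zero    = x
at (_ ∷ μ) (suc i) = at μ i

at-tabulate : ∀ {m} (f : Fin m → ℕ) x → at (tabulate f) (toℕ x) ≡ f x
at-tabulate f zero    = refl
at-tabulate f (suc x) = at-tabulate (f ∘ suc) x

at-ext : ∀ {m} {μ μ′} → length μ ≡ m → length μ′ ≡ m → (∀ (x : Fin m) → at μ (toℕ x) ≡ at μ′ (toℕ x)) →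
         μ ≡ μ′
at-ext {zero}  {[]}    {[]}      _ _ _ = refl
at-ext {suc m} {_ ∷ μ} {_ ∷ μ′} |μ| |μ′| μ≗μ′ =
  cong₂ _∷_ (μ≗μ′ zero) (at-ext (ℕ.suc-injective |μ|) (ℕ.suc-injective |μ′|) (μ≗μ′ ∘ suc))

weight-tabulate : ∀ {m} (g : Fin m → ℕ) μ → weight (tabulate g) μ ≡ ∑[ x < m ] (at μ (toℕ x) * g x)
weight-tabulate {zero}  g μ       = refl
weight-tabulate {suc m} g []      = sym (sum-replicate-zero (suc m))
weight-tabulate {suc m} g (k ∷ μ) = cong (k * g zero +_) (weight-tabulate (g ∘ suc) μ)

multiplicity : ∀ {m} → Fin m → List (Fin m) → ℕ
multiplicity x []       = 0
multiplicity x (y ∷ ys) = δ x y + multiplicity x ys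

module _ {m : ℕ} where

  multiplicity-++ : ∀ (x : Fin m) us vs → multiplicity x (us ++ vs) ≡ multiplicity x us + multiplicity x vs
  multiplicity-++ x []       vs = refl
  multiplicity-++ x (u ∷ us) vs = trans (cong (δ x u +_) (multiplicity-++ x us vs)) (sym (ℕ.+-assoc (δ x u) _ _))

  multiplicity-replicate : ∀ (x : Fin m) k p → multiplicity x (replicate k p) ≡ δ x p * k
  multiplicity-replicate x zero    p = sym (ℕ.*-zeroʳ (δ x p))
  multiplicity-replicate x (suc k) p = trans (cong (δ x p +_) (multiplicity-replicate x k p)) (sym (ℕ.*-suc (δ x p) k))

  multiplicity≥1⇒∈ : ∀ (x : Fin m) ps → 1 ≤ multiplicity x ps → x ∈ ps
  multiplicity≥1⇒∈ x (y ∷ ys) 1≤ with x ≟ y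
  ... | yes refl = here refl
  ... | no _     = there (multiplicity≥1⇒∈ x ys 1≤)

  multiplicity-∷-self≥1 : ∀ (x : Fin m) ps → 1 ≤ multiplicity x (x ∷ ps)
  multiplicity-∷-self≥1 x ps = subst (λ d → 1 ≤ d + multiplicity x ps) (sym (δ-refl x)) (s≤s z≤n)

  sum-map≡∑-multiplicity : ∀ ps (g : Fin m → ℕ) → sum (map g ps) ≡ ∑[ x < m ] (multiplicity x ps * g x)
  sum-map≡∑-multiplicity []       g = sym (sum-replicate-zero m)
  sum-map≡∑-multiplicity (p ∷ ps) g = begin
    g p + sum (map g ps)
      ≡⟨ cong₂ _+_ (∑-δ p g) (sym (sum-map≡∑-multiplicity ps g)) ⟨
    ∑[ x < m ] (δ x p * g x) + ∑[ x < m ] (multiplicity x ps * g x)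
      ≡⟨ ∑-distrib-+ (λ x → δ x p * g x) (λ x → multiplicity x ps * g x) ⟨
    ∑[ x < m ] (δ x p * g x + multiplicity x ps * g x)
      ≡⟨ sum-cong-≗ (λ x → ℕ.*-distribʳ-+ (g x) (δ x p) (multiplicity x ps)) ⟨
    ∑[ x < m ] (multiplicity x (p ∷ ps) * g x) ∎
    where open ≡-Reasoning

  expand : (Fin m → ℕ) → List (Fin m)
  expand f = concatMap (λ p → replicate (f p) p) (allFin m)

  multiplicity-expand : ∀ x f → multiplicity x (expand f) ≡ f x
  multiplicity-expand x f = begin
    multiplicity x (concatMap (λ p → replicate (f p) p) (allFin m)) ≡⟨ multiplicity-blocks (allFin m) ⟩
    sum (map (λ p → δ x p * f p) (allFin m))  ≡⟨ cong sum (map-tabulate id (λ p → δ x p * f p)) ⟩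
    sum (tabulate (λ p → δ x p * f p))        ≡⟨ sum-tabulate (λ p → δ x p * f p) ⟩
    ∑[ p < m ] (δ x p * f p)                  ≡⟨ sum-cong-≗ (λ p → cong (_* f p) (δ-sym x p)) ⟩
    ∑[ p < m ] (δ p x * f p)                  ≡⟨ ∑-δ x f ⟩
    f x                                       ∎
    where
    open ≡-Reasoning
    multiplicity-blocks : ∀ qs → multiplicity x (concatMap (λ p → replicate (f p) p) qs) ≡
                                 sum (map (λ p → δ x p * f p) qs)
    multiplicity-blocks []       = refl
    multiplicity-blocks (q ∷ qs) = trans (multiplicity-++ x (replicate (f q) q) _)
      (cong₂ _+_ (multiplicity-replicate x (f q) q) (multiplicity-blocks qs))

module SortedByKey {ℓ₁ ℓ₂} {X : Set} {_≈_ : Rel X ℓ₁} {_≺_ : Rel X ℓ₂}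
                   (isSTO : IsStrictTotalOrder _≈_ _≺_) {m} (key : Fin m → List X) where

  open LyndonWords isSTO

  Sorted : List (Fin m) → Set (ℓ₁ ⊔ ℓ₂)
  Sorted = Linked (λ p q → key q ⊑ key p)

  Sorted⇒⊑-head : ∀ {q qs x} → Sorted (q ∷ qs) → x ∈ q ∷ qs → key x ⊑ key q
  Sorted⇒⊑-head _              (here refl)  = ⊑-refl
  Sorted⇒⊑-head (r⊑q ∷ sorted) (there x∈qs) =
    All.lookup (Linked⇒All (λ q⊑p r⊑q → ⊑-trans r⊑q q⊑p) r⊑q sorted) x∈qs

  insert : Fin m → List (Fin m) → List (Fin m)
  insert p []       = p ∷ []
  insert p (q ∷ qs) with compare (key p) (key q)
  ... | tri< _ _ _ = q ∷ insert p qs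
  ... | tri≈ _ _ _ = p ∷ q ∷ qs
  ... | tri> _ _ _ = p ∷ q ∷ qs

  sort : List (Fin m) → List (Fin m)
  sort = foldr insert []

  insert-sorted : ∀ p qs → Sorted qs → Sorted (insert p qs)
  insert-sorted p [] _ = [-]
  insert-sorted p (q ∷ qs) sorted with compare (key p) (key q)
  ... | tri< p⊏q _ _ = below q qs (⊏-asym p⊏q) sorted
    where
    below : ∀ r qs → key p ⊑ key r → Sorted (r ∷ qs) → Sorted (r ∷ insert p qs)
    below r [] p⊑r _ = p⊑r ∷ [-]
    below r (q ∷ qs) p⊑r (q⊑r ∷ sorted) with compare (key p) (key q)
    ... | tri< p⊏q _ _ = q⊑r ∷ below q qs (⊏-asym p⊏q) sorted
    ... | tri≈ q⊑p _ _ = p⊑r ∷ q⊑p ∷ sorted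
    ... | tri> q⊑p _ _ = p⊑r ∷ q⊑p ∷ sorted
  ... | tri≈ q⊑p _ _ = q⊑p ∷ sorted
  ... | tri> q⊑p _ _ = q⊑p ∷ sorted

  sort-sorted : ∀ ps → Sorted (sort ps)
  sort-sorted []       = []
  sort-sorted (p ∷ ps) = insert-sorted p (sort ps) (sort-sorted ps)

  multiplicity-insert : ∀ x p qs → multiplicity x (insert p qs) ≡ δ x p + multiplicity x qs
  multiplicity-insert x p [] = refl
  multiplicity-insert x p (q ∷ qs) with compare (key p) (key q)
  ... | tri< _ _ _ =
    trans (cong (δ x q +_) (multiplicity-insert x p qs)) (x∙yz≈y∙xz (δ x q) (δ x p) (multiplicity x qs))
  ... | tri≈ _ _ _ = refl
  ... | tri> _ _ _ = refl

  multiplicity-sort : ∀ x ps → multiplicity x (sort ps) ≡ multiplicity x ps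
  multiplicity-sort x []       = refl
  multiplicity-sort x (p ∷ ps) = trans (multiplicity-insert x p (sort ps)) (cong (δ x p +_) (multiplicity-sort x ps))

  module _ (key-injective : ∀ {p q} → key p ≋ key q → p ≡ q) where

    sorted-unique : ∀ ps qs → Sorted ps → Sorted qs → (∀ x → multiplicity x ps ≡ multiplicity x qs) →
                    ps ≡ qs
    sorted-unique []       []       _ _ _    = refl
    sorted-unique []       (q ∷ qs) _ _ same =
      ⊥-elim (ℕ.1+n≰n (subst (1 ≤_) (sym (same q)) (multiplicity-∷-self≥1 q qs)))
    sorted-unique (p ∷ ps) []       _ _ same =
      ⊥-elim (ℕ.1+n≰n (subst (1 ≤_) (same p) (multiplicity-∷-self≥1 p ps)))
    sorted-unique (p ∷ ps) (q ∷ qs) p∷ps↘ q∷qs↘ same =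
      cong₂ _∷_ p≡q (sorted-unique ps qs (Linked.tail p∷ps↘) (Linked.tail q∷qs↘) same-tail)
      where
      p∈q∷qs : p ∈ q ∷ qs
      p∈q∷qs = multiplicity≥1⇒∈ p (q ∷ qs) (subst (1 ≤_) (same p) (multiplicity-∷-self≥1 p ps))
      q∈p∷ps : q ∈ p ∷ ps
      q∈p∷ps = multiplicity≥1⇒∈ q (p ∷ ps) (subst (1 ≤_) (sym (same q)) (multiplicity-∷-self≥1 q qs))
      p≡q : p ≡ q
      p≡q with compare (key p) (key q)
      ... | tri< p⊏q _ _ = ⊥-elim (Sorted⇒⊑-head p∷ps↘ q∈p∷ps p⊏q)
      ... | tri≈ _ p≋q _ = key-injective p≋q
      ... | tri> _ _ q⊏p = ⊥-elim (Sorted⇒⊑-head q∷qs↘ p∈q∷qs q⊏p)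
      same-tail : ∀ x → multiplicity x ps ≡ multiplicity x qs
      same-tail x = ℕ.+-cancelˡ-≡ (δ x p) _ _ (trans (same x) (cong (λ r → δ x r + multiplicity x qs) (sym p≡q)))

-- Set partitions as multisets of Lyndon set partitions

module LyndonMultisets (O : AtomOrder) (b : ℕ → ℕ)
                       (b-count : ∀ k → HasCount (λ (A : Matrix k) → IsLyndonSP O A) (b k)) where

  open AtomOrder O
  open LyndonWords isSTO

  private
    lyndonMatrices : ∀ k → List (Matrix k)
    lyndonMatrices k = proj₁ (b-count k)

    lyndonMatrices-unique : ∀ k → Unique (lyndonMatrices k)
    lyndonMatrices-unique k = proj₁ (proj₂ (b-count k))

    length-lyndonMatrices : ∀ k → length (lyndonMatrices k) ≡ b k
    length-lyndonMatrices k = proj₁ (proj₂ (proj₂ (b-count k)))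

    ∈-lyndonMatrices⇔ : ∀ {k} (A : Matrix k) → A ∈ lyndonMatrices k ⇔ IsLyndonSP O A
    ∈-lyndonMatrices⇔ {k} = proj₂ (proj₂ (proj₂ (b-count k)))

  lyndonsOfSize : ℕ → List SP
  lyndonsOfSize k = map (k ,_) (lyndonMatrices k)

  lyndonsUpTo : ℕ → List SP
  lyndonsUpTo zero    = []
  lyndonsUpTo (suc K) = lyndonsUpTo K ++ lyndonsOfSize (suc K)

  ∈-lyndonsUpTo⁻ : ∀ {K s} → s ∈ lyndonsUpTo K → 1 ≤ proj₁ s × proj₁ s ≤ K × IsLyndonSP O (proj₂ s)
  ∈-lyndonsUpTo⁻ {suc K} s∈ with ∈-++⁻ (lyndonsUpTo K) s∈
  ... | inj₁ s∈≤K = let 1≤ , ≤K , lyndon = ∈-lyndonsUpTo⁻ s∈≤K in 1≤ , ℕ.m≤n⇒m≤1+n ≤K , lyndon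
  ... | inj₂ s∈=K with ∈-map⁻ (suc K ,_) s∈=K
  ...   | A , A∈ , refl = s≤s z≤n , ℕ.≤-refl , Equivalence.to (∈-lyndonMatrices⇔ A) A∈

  ∈-lyndonsUpTo⁺ : ∀ {K k} {A : Matrix k} → 1 ≤ k → k ≤ K → IsLyndonSP O A → (k , A) ∈ lyndonsUpTo K
  ∈-lyndonsUpTo⁺ {zero}  1≤k k≤0 _ = ⊥-elim (ℕ.<⇒≱ 1≤k k≤0)
  ∈-lyndonsUpTo⁺ {suc K} {A = A} 1≤k k≤1+K lyndon with ℕ.m≤n⇒m<n∨m≡n k≤1+K
  ... | inj₁ k<1+K = ∈-++⁺ˡ (∈-lyndonsUpTo⁺ 1≤k (ℕ.≤-pred k<1+K) lyndon)
  ... | inj₂ refl  = ∈-++⁺ʳ (lyndonsUpTo K)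
                       (∈-map⁺ (suc K ,_) (Equivalence.from (∈-lyndonMatrices⇔ A) lyndon))

  lyndonsUpTo-unique : ∀ K → Unique (lyndonsUpTo K)
  lyndonsUpTo-unique zero    = []
  lyndonsUpTo-unique (suc K) =
    Unique.++⁺ (lyndonsUpTo-unique K)
               (Unique.map⁺ (,-injectiveʳ-UIP ℕ.≡-irrelevant) (lyndonMatrices-unique (suc K)))
      λ (s∈≤K , s∈=K) →
        let _ , _ , s≡ = ∈-map⁻ (suc K ,_) s∈=K
        in ℕ.1+n≰n (subst (_≤ K) (cong proj₁ s≡) (proj₁ (proj₂ (∈-lyndonsUpTo⁻ s∈≤K))))

  sizes-lyndonsUpTo : ∀ K → map proj₁ (lyndonsUpTo K) ≡ sizes b K
  sizes-lyndonsUpTo zero    = refl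
  sizes-lyndonsUpTo (suc K) = begin
    map proj₁ (lyndonsUpTo K ++ lyndonsOfSize (suc K))
      ≡⟨ map-++ proj₁ (lyndonsUpTo K) (lyndonsOfSize (suc K)) ⟩
    map proj₁ (lyndonsUpTo K) ++ map proj₁ (lyndonsOfSize (suc K))
      ≡⟨ cong₂ _++_ (sizes-lyndonsUpTo K) (map-const (lyndonMatrices (suc K))) ⟩
    sizes b K ++ replicate (length (lyndonMatrices (suc K))) (suc K)
      ≡⟨ cong (λ c → sizes b K ++ replicate c (suc K)) (length-lyndonMatrices (suc K)) ⟩
    sizes b (suc K) ∎
    where
    open ≡-Reasoning
    map-const : (As : List (Matrix (suc K))) →
                map proj₁ (map (_,_ {B = Matrix} (suc K)) As) ≡ replicate (length As) (suc K)
    map-const []       = refl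
    map-const (A ∷ As) = cong (suc K ∷_) (map-const As)

  module _ (N : ℕ) where

    private
      L = lyndonsUpTo N
      M = length L

    item : Fin M → SP
    item = lookup L

    item-lyndon : ∀ p → Σ[ w ∈ List Atom ] (concatAtoms w ≡ item p × IsLyndon O w)
    item-lyndon p = proj₂ (proj₂ (proj₂ (∈-lyndonsUpTo⁻ {K = N} (∈-lookup {xs = L} p))))

    word : Fin M → List Atom
    word p = proj₁ (item-lyndon p)

    concatAtoms-word : ∀ p → concatAtoms (word p) ≡ item p
    concatAtoms-word p = proj₁ (proj₂ (item-lyndon p))

    word-lyndon : ∀ p → Lyndon (word p)
    word-lyndon p = byRotation⇒lyndon (proj₂ (proj₂ (item-lyndon p)))

    word-injective : ∀ {p q} → word p ≋ word q → p ≡ q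
    word-injective {p} {q} p≋q = lookup-injective (lyndonsUpTo-unique N) p q
      (trans (sym (concatAtoms-word p)) (trans (concatAtoms-resp p≋q) (concatAtoms-word q)))

    open SortedByKey isSTO word

    glue : List (Fin M) → SP
    glue ps = concatAtoms (concat (map word ps))

    size-glue : ∀ ps → proj₁ (glue ps) ≡ sum (map (proj₁ ∘ item) ps)
    size-glue []       = refl
    size-glue (p ∷ ps) = trans (size-concatAtoms-++ (word p) (concat (map word ps)))
                               (cong₂ _+_ (cong proj₁ (concatAtoms-word p)) (size-glue ps))

    weight≡size-glue : ∀ {μ} ps → length μ ≡ M → (∀ x → multiplicity x ps ≡ at μ (toℕ x)) →
                       weight (sizes b N) μ ≡ proj₁ (glue ps)
    weight≡size-glue {μ} ps |μ| multiplicities = begin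
      weight (sizes b N) μ                 ≡⟨ cong (λ s → weight s μ) (sizes-lyndonsUpTo N) ⟨
      weight (map proj₁ L) μ               ≡⟨ cong (λ s → weight (map proj₁ s) μ) (tabulate-lookup L) ⟨
      weight (map proj₁ (tabulate item)) μ ≡⟨ cong (λ s → weight s μ) (map-tabulate item proj₁) ⟩
      weight (tabulate (proj₁ ∘ item)) μ   ≡⟨ weight-tabulate (proj₁ ∘ item) μ ⟩
      ∑[ x < M ] (at μ (toℕ x) * proj₁ (item x))
        ≡⟨ sum-cong-≗ (λ x → cong (_* proj₁ (item x)) (multiplicities x)) ⟨
      ∑[ x < M ] (multiplicity x ps * proj₁ (item x))
        ≡⟨ sum-map≡∑-multiplicity ps (proj₁ ∘ item) ⟨
      sum (map (proj₁ ∘ item) ps)          ≡⟨ size-glue ps ⟨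
      proj₁ (glue ps)                      ∎
      where open ≡-Reasoning

    -- μ counts how often each member of lyndonsUpTo N occurs as a Lyndon factor of A.
    record Represents {n} (μ : List ℕ) (A : Matrix n) : Set where
      field
        length≡        : length μ ≡ M
        positions      : List (Fin M)
        sorted         : Sorted positions
        glue≡          : glue positions ≡ (n , A)
        multiplicities : ∀ x → multiplicity x positions ≡ at μ (toℕ x)

    length-sizes : length (sizes b N) ≡ M
    length-sizes = trans (cong length (sym (sizes-lyndonsUpTo N))) (length-map proj₁ L)

    vector⇒setPartition : ∀ {n μ} → μ ∈ productFamily b N n →
                          Σ[ A ∈ Matrix n ] (IsSetPartition A × Represents μ A)
    vector⇒setPartition {n} {μ} μ∈ = A , A-sp , record
      { length≡ = |μ| ; positions = ps ; sorted = sort-sorted unsorted ; glue≡ = glue≡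
      ; multiplicities = multiplicities }
      where
      sound = Enumerates.sound (product-enumerates b N) μ∈
      |μ| = trans (proj₁ sound) length-sizes
      unsorted = expand (λ x → at μ (toℕ x))
      ps = sort unsorted
      multiplicities : ∀ x → multiplicity x ps ≡ at μ (toℕ x)
      multiplicities x = trans (multiplicity-sort x unsorted) (multiplicity-expand x (λ x → at μ (toℕ x)))
      size≡n : proj₁ (glue ps) ≡ n
      size≡n = trans (sym (weight≡size-glue ps |μ| multiplicities)) (proj₂ sound)
      A = subst Matrix size≡n (proj₂ (glue ps))
      glue≡ : glue ps ≡ (n , A)
      glue≡ = Σ-≡,≡→≡ (size≡n , refl)
      A-sp : IsSetPartition A
      A-sp = subst (IsSetPartition ∘ proj₂) glue≡
               (ℕ⇒isSetPartition _ (concatAtoms-isSetPartitionℕ (concat (map word ps))))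

    position : ∀ f → Lyndon f → proj₁ (concatAtoms f) ≤ N → Σ[ p ∈ Fin M ] word p ≋ f
    position f f-lyndon size≤N =
      index f∈L , concatAtoms-injective _ f (trans (concatAtoms-word _) (sym (lookup-index f∈L)))
      where
      f∈L : concatAtoms f ∈ L
      f∈L = ∈-lyndonsUpTo⁺ (size-concatAtoms≥1 f (Lyndon⇒nonEmpty f-lyndon)) size≤N
              (ℕ⇒isSetPartition _ (concatAtoms-isSetPartitionℕ f) , f , refl , lyndon⇒byRotation f-lyndon)

    positions : ∀ fs → All Lyndon fs → proj₁ (concatAtoms (concat fs)) ≤ N →
                Σ[ ps ∈ List (Fin M) ] Pointwise _≋_ (map word ps) fs
    positions []       []                      _      = [] , []
    positions (f ∷ fs) (f-lyndon ∷ fs-lyndon) size≤N =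
      let p , p≋f = position f f-lyndon (ℕ.≤-trans (ℕ.m≤m+n _ _) size≤N′)
          ps , ps≋fs = positions fs fs-lyndon (ℕ.≤-trans (ℕ.m≤n+m _ (proj₁ (concatAtoms f))) size≤N′)
      in p ∷ ps , p≋f ∷ ps≋fs
      where
      size≤N′ : proj₁ (concatAtoms f) + proj₁ (concatAtoms (concat fs)) ≤ N
      size≤N′ = subst (_≤ N) (size-concatAtoms-++ f (concat fs)) size≤N

    setPartition⇒vector : ∀ {n} {A : Matrix n} → n ≤ N → IsSetPartition A →
                          Σ[ μ ∈ List ℕ ] (μ ∈ productFamily b N n × Represents μ A)
    setPartition⇒vector {n} {A} n≤N A-sp = μ , μ∈ , record
      { length≡ = |μ| ; positions = ps ; sorted = Linked-map⁻ (NonIncreasing-resp ps≋fs fs↘) ; glue≡ = glue≡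
      ; multiplicities = multiplicities }
      where
      atoms = atomicFactorisation A A-sp
      open LyndonFactorisation (lyndonFactorisation (proj₁ atoms))
        renaming (factors to fs; allLyndon to fs-lyndon; nonIncreasing to fs↘)
      concatAtoms-fs : concatAtoms (concat fs) ≡ (n , A)
      concatAtoms-fs = trans (cong concatAtoms concat-factors) (proj₂ atoms)
      ps≋ = positions fs fs-lyndon (subst (_≤ N) (sym (cong proj₁ concatAtoms-fs)) n≤N)
      ps = proj₁ ps≋
      ps≋fs = proj₂ ps≋
      glue≡ : glue ps ≡ (n , A)
      glue≡ = trans (concatAtoms-resp (Pointwise.concat⁺ ps≋fs)) concatAtoms-fs
      μ = tabulate (λ x → multiplicity x ps)
      |μ| : length μ ≡ M
      |μ| = length-tabulate _
      multiplicities : ∀ x → multiplicity x ps ≡ at μ (toℕ x)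
      multiplicities x = sym (at-tabulate _ x)
      μ∈ : μ ∈ productFamily b N n
      μ∈ = Enumerates.complete (product-enumerates b N)
             (trans |μ| (sym length-sizes))
             (trans (weight≡size-glue ps |μ| multiplicities) (cong proj₁ glue≡))

    represents-injective : ∀ {n μ μ′} {A : Matrix n} → Represents μ A → Represents μ′ A → μ ≡ μ′
    represents-injective R R′ =
      at-ext R.length≡ R′.length≡ λ x → trans (sym (R.multiplicities x))
                                          (trans (cong (multiplicity x) ps≡ps′) (R′.multiplicities x))
      where
      module R = Represents R
      module R′ = Represents R′
      lyndons : ∀ ps → All Lyndon (map word ps)
      lyndons ps = All-map⁺ (All.universal word-lyndon ps)
      factors≋ : Pointwise _≋_ (map word R.positions) (map word R′.positions)
      factors≋ = factorisation-unique _ _ (lyndons R.positions) (Linked-map⁺ R.sorted)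
                                          (lyndons R′.positions) (Linked-map⁺ R′.sorted)
                   (concatAtoms-injective _ _ (trans R.glue≡ (sym R′.glue≡)))
      ps≡ps′ : R.positions ≡ R′.positions
      ps≡ps′ = Pointwise.Pointwise-≡⇒≡ (Pointwise.map word-injective (Pointwise.map⁻ word word factors≋))

    represents-functional : ∀ {n μ} {A A′ : Matrix n} → Represents μ A → Represents μ A′ → A ≡ A′
    represents-functional R R′ = ,-injectiveʳ-UIP ℕ.≡-irrelevant
      (trans (sym R.glue≡) (trans (cong glue ps≡ps′) R′.glue≡))
      where
      module R = Represents R
      module R′ = Represents R′
      ps≡ps′ : R.positions ≡ R′.positions
      ps≡ps′ = sorted-unique word-injective R.positions R′.positions R.sorted R′.sorted
                 (λ x → trans (R.multiplicities x) (sym (R′.multiplicities x)))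

    prodUpTo≡count : ∀ {n c} → n ≤ N → HasCount (λ (A : Matrix n) → IsSetPartition A) c → prodUpTo b N n ≡ c
    prodUpTo≡count {n} {c} n≤N (As , As-unique , |As|≡c , ∈As⇔) = begin
      prodUpTo b N n                   ≡⟨ length-productFamily b N n ⟨
      length (productFamily b N n)     ≡⟨ bijection⇒length≡ Represents represents-injective represents-functional
                                            _ As (Enumerates.unique (product-enumerates b N) n) As-unique to from ⟩
      length As                        ≡⟨ |As|≡c ⟩
      c                                ∎
      where
      open ≡-Reasoning
      to : ∀ {μ} → μ ∈ productFamily b N n → Σ[ A ∈ Matrix n ] (A ∈ As × Represents μ A)
      to μ∈ = let A , A-sp , R = vector⇒setPartition μ∈ in A , Equivalence.from (∈As⇔ A) A-sp , R
      from : ∀ {A} → A ∈ As → Σ[ μ ∈ List ℕ ] (μ ∈ productFamily b N n × Represents μ A)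
      from {A} A∈ = setPartition⇒vector n≤N (Equivalence.to (∈As⇔ A) A∈)

mainTheorem4 : (O : AtomOrder) (b B : ℕ → ℕ)
    → ((k : ℕ) → HasCount (λ (A : Matrix k) → IsLyndonSP O A) (b k))
    → ((n : ℕ) → HasCount (λ (A : Matrix n) → IsSetPartition A) (B n))
    → (N n : ℕ) → n ≤ N → prodUpTo b N n ≡ B n
mainTheorem4 O b B b-count B-count N n n≤N = LyndonMultisets.prodUpTo≡count O b b-count N n≤N (B-count n)
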